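{- Let $S=\{1,m\}$ be admissible (i.e. $3\le m\le n-1$). Then \[\#\widehat{P}(\{1,m\},n)=\sum_{i=1}^{m-2}\binom{n}{m-i}\left(2^{m-i-1}-1\right)2^{\,n-(m-i+1)}(-1)^{i+1}-(m\bmod 2)\left(2^{n-1}-1\right).\]
   Context: $S_n$ is the set of permutations $\pi=\pi_1\cdots\pi_n$ of $\{1,\dots,n\}$. Set $\pi_0=0$. An index $i\in\{1,\dots,n-1\}$ is a peak of $\pi$ if $\pi_{i-1}<\pi_i>\pi_{i+1}$. $\widehat{P}(S,n)$ is the set of $\pi\in S_n$ whose peak set (in this sense) equals $S$. $m\bmod 2\in\{0,1\}$ is the remainder of $m$ modulo $2$. -}

module Defs where

open import Data.Nat using (ℕ; zero; suc; _+_; _∸_; _<ᵇ_)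
open import Data.Bool using (Bool; true; false; _∧_; if_then_else_)
open import Data.List using (List; []; _∷_; map; concatMap; filter; length; upTo)
import Data.List
open import Data.List.Relation.Unary.Unique.Propositional using (Unique)
open import Data.List.Relation.Unary.Unique.Propositional.Properties using ()
open import Data.List.Relation.Unary.Unique.DecPropositional using (unique?)
open import Data.Nat.Properties using (_≟_)
open import Relation.Binary.PropositionalEquality using (_≡_)
open import Data.List.Properties using (≡-dec)
open import Relation.Nullary.Decidable using (⌊_⌋)

words : ℕ → ℕ → List (List ℕ)
words n zero    = [] ∷ []
words n (suc k) = concatMap (λ a → map (a ∷_) (words n k)) (map suc (upTo n))

perms : ℕ → List (List ℕ)
perms n = filter (λ w → unique? _≟_ w) (words n n)

peaksFrom : ℕ → ℕ → List ℕ → List ℕ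
peaksFrom prev i []           = []
peaksFrom prev i (x ∷ [])     = []
peaksFrom prev i (x ∷ y ∷ ws) =
  if (prev <ᵇ x) ∧ (y <ᵇ x)
  then i ∷ peaksFrom x (suc i) (y ∷ ws)
  else peaksFrom x (suc i) (y ∷ ws)

-- peak set of π (with the convention π₀ = 0), listed in increasing order
peakSet : List ℕ → List ℕ
peakSet π = peaksFrom 0 1 π

-- #P̂(S,n) for S given as a strictly increasing list of indices
countPeakSet : List ℕ → ℕ → ℕ
countPeakSet S n = length (filter (λ π → ≡-dec _≟_ (peakSet π) S) (perms n))

-- Σ_{i=a}^{b} f i over integers (empty if b < a)
open import Data.Integer as ℤ using (ℤ)
sumℤ : ℕ → ℕ → (ℕ → ℤ) → ℤ
sumℤ a b f = Data.List.foldr ℤ._+_ (ℤ.+ 0) (map (λ j → f (a + j)) (upTo (suc b ∸ a)))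

-- Every permutation of {1,…,n+1} arises exactly once by inserting n + 1 into a permutation
-- of {1,…,n}, and the effect on the peak set is explicit: inserting at position p destroys
-- the peaks at p - 1 and p, shifts the later ones to the right, and creates the peak p
-- unless p is the last position. Counting, for a target peak set S, the (peak set,
-- position) pairs that produce S gives linear recurrences for the numbers of permutations
-- with peak set ∅, {k} and {1,m}. Their solutions are closed forms for the sums
-- #{k+1} + #{k} + 1 = C(n,k) 2^(n-1-k) and #{1,m+1} + #{1,m} + #{1} = C(n,m) (2^(n-2) - 2^(n-1-m)),
-- and the second one, applied for consecutive m, telescopes into the alternating sum.
module Submission where

open import Defs

module PeakSetCounts where

  open import Data.Nat using (ℕ; zero; suc; _+_; _*_; _^_; _∸_; _≤_; _<_; z≤n; s≤s; _<ᵇ_; _<?_)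
  open import Data.Nat.Properties
    using ( _≟_; ≤-refl; ≤-pred; ≤-trans; ≤-antisym; <-trans; ≤-<-trans; <-irrefl; <-asym; <⇒≤; ≮⇒≥; ≤⇒≯; ≤∧≢⇒<
          ; m≤n⇒m≤1+n; 1+n≰n; n≤1+n; n<1+n; m≤n+m; m≤n⇒m<n∨m≡n; suc-injective; <ᵇ⇒<
          ; +-suc; +-comm; +-assoc; +-identityʳ; *-identityˡ; *-distribʳ-+; +-commutativeSemigroup
          ; n∸n≡0; m+n∸n≡m; +-∸-assoc)
  open import Data.Nat.Combinatorics using (_C_; nCk+nC[k+1]≡[n+1]C[k+1]; nCk≡nC[n∸k]; nC1≡n)
  open import Data.Nat.Solver using (module +-*-Solver)
  open +-*-Solver using (solve; _:+_; _:*_; _:=_; con)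
  open import Data.Bool using (Bool; T; true; false; _∧_; if_then_else_)
  open import Data.Bool.Properties using (∧-zeroʳ; if-float)
  open import Data.Unit using (⊤; tt)
  open import Data.List using (List; []; _∷_; _++_; map; concatMap; filter; length; upTo)
  open import Data.List.Properties
    using (≡-dec; ∷-injective; map-injective; length-++-≤ˡ; filter-all; filter-none; filter-accept; filter-reject; ++-identityʳ)
  open import Data.List.Membership.Propositional using (_∈_; _∉_; find)
  open import Data.List.Membership.Propositional.Properties
    using ( ∈-map⁺; ∈-map⁻; ∈-∃++; ∈-concatMap⁺; ∈-concatMap⁻; ∈-upTo⁺; ∈-upTo⁻
          ; ∈-filter⁺; ∈-filter⁻; ∈-++⁺ˡ; ∈-++⁺ʳ; ∈-++⁻)
  open import Data.List.Membership.DecPropositional _≟_ using (_∈?_)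
  open import Data.List.Membership.Propositional.Properties.WithK using (unique∧set⇒bag)
  open import Data.List.Relation.Unary.All as All using (All; []; _∷_)
  import Data.List.Relation.Unary.All.Properties as All
  open import Data.List.Relation.Unary.Any as Any using (here; there)
  open import Data.List.Relation.Unary.Unique.Propositional using (Unique; []; _∷_)
  import Data.List.Relation.Unary.Unique.Propositional.Properties as Unique
  open import Data.List.Relation.Unary.Unique.DecPropositional using (unique?)
  open import Data.List.Relation.Binary.Permutation.Propositional using (_↭_)
  open import Data.List.Relation.Binary.Permutation.Propositional.Properties using (↭-length; filter-↭)
  open import Data.List.Relation.Binary.BagAndSetEquality using (∼bag⇒↭)
  open import Data.Product using (∃₂; _×_; _,_; proj₁; proj₂)
  open import Data.Sum using (inj₁; inj₂)
  open import Data.Empty using (⊥-elim)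
  open import Function using (case_of_)
  open import Function.Bundles using (_⇔_; mk⇔; Equivalence)
  open import Relation.Nullary using (Dec; yes; no; ¬_)
  open import Relation.Unary using (Pred; Decidable; ∁)
  open import Relation.Binary.Definitions using (DecidableEquality)
  open import Relation.Binary.PropositionalEquality using (_≡_; _≢_; refl; sym; trans; cong; cong₂; subst)
  open Relation.Binary.PropositionalEquality.≡-Reasoning
  open import Algebra.Properties.CommutativeSemigroup +-commutativeSemigroup using ()
    renaming (interchange to +-interchange)

  -- Permutations as insertions of the maximum

  unique-map-on : ∀ {A B : Set} (f : A → B) xs →
                  (∀ {x y} → x ∈ xs → y ∈ xs → f x ≡ f y → x ≡ y) → Unique xs → Unique (map f xs)
  unique-map-on f []       inj []         = []
  unique-map-on f (x ∷ xs) inj (x∉ ∷ uxs) =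
    All.tabulate (λ z∈ fx≡z → let (y , y∈ , z≡fy) = ∈-map⁻ f z∈ in
                   All.lookup x∉ y∈ (inj (here refl) (there y∈) (trans fx≡z z≡fy)))
    ∷ unique-map-on f xs (λ p q → inj (there p) (there q)) uxs

  unique-concatMap : ∀ {A B : Set} (f : A → List B) xs → Unique xs →
                     (∀ {x} → x ∈ xs → Unique (f x)) →
                     (∀ {x y z} → x ∈ xs → y ∈ xs → z ∈ f x → z ∈ f y → x ≡ y) →
                     Unique (concatMap f xs)
  unique-concatMap f []       []         uf disj = []
  unique-concatMap f (x ∷ xs) (x∉ ∷ uxs) uf disj =
    Unique.++⁺ (uf (here refl))
      (unique-concatMap f xs uxs (λ p → uf (there p)) (λ p q → disj (there p) (there q)))
      λ (z∈fx , z∈rest) → let (y , y∈ , z∈fy) = find (∈-concatMap⁻ f {xs = xs} z∈rest) in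
                          All.lookup x∉ y∈ (disj (here refl) (there y∈) z∈fx z∈fy)

  InRange : ℕ → ℕ → Set
  InRange n x = 1 ≤ x × x ≤ n

  IsPermutation : ℕ → List ℕ → Set
  IsPermutation n w = length w ≡ n × All (InRange n) w × Unique w

  ∈-words⁻ : ∀ n k {w} → w ∈ words n k → length w ≡ k × All (InRange n) w
  ∈-words⁻ n zero    (here refl) = refl , []
  ∈-words⁻ n (suc k) w∈ =
    let (a , a∈ , w∈a∷) = find (∈-concatMap⁻ (λ a → map (a ∷_) (words n k)) {xs = map suc (upTo n)} w∈)
        (b , b∈ , a≡1+b) = ∈-map⁻ suc a∈
        (v , v∈ , w≡a∷v) = ∈-map⁻ (a ∷_) w∈a∷
        (length-v , range-v) = ∈-words⁻ n k v∈
    in subst (λ w → length w ≡ suc k × All (InRange n) w) (sym w≡a∷v)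
         (cong suc length-v , subst (InRange n) (sym a≡1+b) (s≤s z≤n , ∈-upTo⁻ b∈) ∷ range-v)

  ∈-words⁺ : ∀ n k {w} → length w ≡ k → All (InRange n) w → w ∈ words n k
  ∈-words⁺ n zero    {[]}    refl []                       = here refl
  ∈-words⁺ n (suc k) {x ∷ w} len  ((s≤s {n = x′} _ , x≤n) ∷ range) =
    ∈-concatMap⁺ (λ a → map (a ∷_) (words n k))
      (Any.map (λ { refl → ∈-map⁺ (suc x′ ∷_) (∈-words⁺ n k (suc-injective len) range) })
               (∈-map⁺ suc (∈-upTo⁺ x≤n)))

  words-unique : ∀ n k → Unique (words n k)
  words-unique n zero    = [] ∷ []
  words-unique n (suc k) =
    unique-concatMap (λ a → map (a ∷_) (words n k)) (map suc (upTo n))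
      (Unique.map⁺ suc-injective (Unique.upTo⁺ n))
      (λ _ → Unique.map⁺ (λ e → proj₂ (∷-injective e)) (words-unique n k))
      λ {x} {y} _ _ z∈x z∈y →
        let (_ , _ , e₁) = ∈-map⁻ (x ∷_) z∈x
            (_ , _ , e₂) = ∈-map⁻ (y ∷_) z∈y
        in proj₁ (∷-injective (trans (sym e₁) e₂))

  perms-unique : ∀ n → Unique (perms n)
  perms-unique n = Unique.filter⁺ (unique? _≟_) (words-unique n n)

  ∈-perms⁻ : ∀ n {w} → w ∈ perms n → IsPermutation n w
  ∈-perms⁻ n w∈ =
    let (w∈words , unique-w) = ∈-filter⁻ (unique? _≟_) {xs = words n n} w∈
        (length-w , range-w) = ∈-words⁻ n n w∈words
    in length-w , range-w , unique-w

  ∈-perms⁺ : ∀ n {w} → IsPermutation n w → w ∈ perms n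
  ∈-perms⁺ n (len , range , uniq) = ∈-filter⁺ (unique? _≟_) (∈-words⁺ n n len range) uniq

  insertAt : ℕ → ℕ → List ℕ → List ℕ
  insertAt zero    b xs       = b ∷ xs
  insertAt (suc q) b []       = b ∷ []
  insertAt (suc q) b (x ∷ xs) = x ∷ insertAt q b xs

  insertions : ℕ → List ℕ → List (List ℕ)
  insertions n π = map (λ q → insertAt q (suc n) π) (upTo (suc n))

  permsByInsertion : ℕ → List (List ℕ)
  permsByInsertion zero    = [] ∷ []
  permsByInsertion (suc n) = concatMap (insertions n) (permsByInsertion n)

  length-insertAt : ∀ q b xs → length (insertAt q b xs) ≡ suc (length xs)
  length-insertAt zero    b xs       = refl
  length-insertAt (suc q) b []       = refl
  length-insertAt (suc q) b (x ∷ xs) = cong suc (length-insertAt q b xs)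

  All-insertAt : ∀ {P : ℕ → Set} q b xs → P b → All P xs → All P (insertAt q b xs)
  All-insertAt zero    b xs       pb all         = pb ∷ all
  All-insertAt (suc q) b []       pb all         = pb ∷ []
  All-insertAt (suc q) b (x ∷ xs) pb (px ∷ all) = px ∷ All-insertAt q b xs pb all

  insertAt-unique : ∀ q b xs → b ∉ xs → Unique xs → Unique (insertAt q b xs)
  insertAt-unique zero    b xs       b∉ uxs        = All.¬Any⇒All¬ xs b∉ ∷ uxs
  insertAt-unique (suc q) b []       b∉ uxs        = [] ∷ []
  insertAt-unique (suc q) b (x ∷ xs) b∉ (x∉ ∷ uxs) =
    All-insertAt q b xs (λ e → b∉ (here (sym e))) x∉ ∷ insertAt-unique q b xs (λ p → b∉ (there p)) uxs

  insertAt-injective : ∀ q q′ b xs ys → b ∉ xs → b ∉ ys → q ≤ length xs → q′ ≤ length ys →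
                       insertAt q b xs ≡ insertAt q′ b ys → q ≡ q′ × xs ≡ ys
  insertAt-injective zero    zero     b xs       ys       _  _   _         _          e =
    refl , proj₂ (∷-injective e)
  insertAt-injective zero    (suc q′) b xs       []       _  _   _         ()         _
  insertAt-injective zero    (suc q′) b xs       (y ∷ ys) _  b∉′ _         _          e =
    ⊥-elim (b∉′ (here (proj₁ (∷-injective e))))
  insertAt-injective (suc q) q′       b []       ys       _  _   ()        _          _
  insertAt-injective (suc q) zero     b (x ∷ xs) ys       b∉ _   _         _          e =
    ⊥-elim (b∉ (here (sym (proj₁ (∷-injective e)))))
  insertAt-injective (suc q) (suc q′) b (x ∷ xs) []       _  _   _         ()         _
  insertAt-injective (suc q) (suc q′) b (x ∷ xs) (y ∷ ys) b∉ b∉′ (s≤s q≤) (s≤s q′≤) e =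
    let (x≡y , rest) = ∷-injective e
        (q≡q′ , xs≡ys) = insertAt-injective q q′ b xs ys (λ p → b∉ (there p)) (λ p → b∉′ (there p)) q≤ q′≤ rest
    in cong suc q≡q′ , cong₂ _∷_ x≡y xs≡ys

  insertAt-++ : ∀ b xs ys → insertAt (length xs) b (xs ++ ys) ≡ xs ++ b ∷ ys
  insertAt-++ b []       ys = refl
  insertAt-++ b (x ∷ xs) ys = cong (x ∷_) (insertAt-++ b xs ys)

  unique-remove : ∀ {b : ℕ} xs ys → Unique (xs ++ b ∷ ys) → Unique (xs ++ ys) × b ∉ xs ++ ys
  unique-remove []       ys (b∉ ∷ uys) = uys , λ p → All.lookup b∉ p refl
  unique-remove (x ∷ xs) ys (x∉ ∷ u)   =
    let (u′ , b∉) = unique-remove xs ys u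
        x∉′ = All.++⁺ (All.++⁻ˡ xs x∉) (All.tail (All.++⁻ʳ xs x∉))
        x≢b = All.head (All.++⁻ʳ xs x∉)
    in (x∉′ ∷ u′) , λ { (here e) → x≢b (sym e) ; (there p) → b∉ p }

  All-remove : ∀ {P : ℕ → Set} {b} xs ys → All P (xs ++ b ∷ ys) → All P (xs ++ ys)
  All-remove xs ys all = All.++⁺ (All.++⁻ˡ xs all) (All.tail (All.++⁻ʳ xs all))

  length-remove : ∀ {b : ℕ} xs ys → length (xs ++ b ∷ ys) ≡ suc (length (xs ++ ys))
  length-remove []       ys = refl
  length-remove (x ∷ xs) ys = cong suc (length-remove xs ys)

  All-InRange-shrink : ∀ k w → All (InRange (suc k)) w → suc k ∉ w → All (InRange k) w
  All-InRange-shrink k []      _                   _  = []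
  All-InRange-shrink k (x ∷ w) ((1≤x , x≤) ∷ all) k∉ =
    (1≤x , ≤-pred (≤∧≢⇒< x≤ (λ e → k∉ (here (sym e)))))
    ∷ All-InRange-shrink k w all (λ p → k∉ (there p))

  removeMax : ∀ k w → Unique w → All (InRange (suc k)) w → suc k ∈ w →
              ∃₂ λ (xs ys : List ℕ) → w ≡ xs ++ suc k ∷ ys × Unique (xs ++ ys) × All (InRange k) (xs ++ ys)
  removeMax k w uw all k∈ with ∈-∃++ k∈
  ... | xs , ys , refl =
    let (u′ , k∉) = unique-remove xs ys uw
    in xs , ys , refl , u′ , All-InRange-shrink k (xs ++ ys) (All-remove xs ys all) k∉

  pigeonhole : ∀ k w → Unique w → All (InRange k) w → length w ≤ k
  pigeonhole zero    []      _  _                       = z≤n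
  pigeonhole zero    (x ∷ w) _  ((1≤x , x≤0) ∷ _) with x≤0 | 1≤x
  ... | z≤n | ()
  pigeonhole (suc k) w       uw all with suc k ∈? w
  ... | no  k∉ = m≤n⇒m≤1+n (pigeonhole k w uw (All-InRange-shrink k w all k∉))
  ... | yes k∈ with removeMax k w uw all k∈
  ...   | xs , ys , refl , u′ , all′ =
    subst (_≤ suc k) (sym (length-remove xs ys)) (s≤s (pigeonhole k (xs ++ ys) u′ all′))

  1+n∉ : ∀ {n π} → All (InRange n) π → suc n ∉ π
  1+n∉ range p = 1+n≰n (proj₂ (All.lookup range p))

  ∈-permsByInsertion⁻ : ∀ n {w} → w ∈ permsByInsertion n → IsPermutation n w
  ∈-permsByInsertion⁻ zero    (here refl) = refl , [] , []
  ∈-permsByInsertion⁻ (suc n) w∈ =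
    let (π , π∈ , w∈′) = find (∈-concatMap⁻ (insertions n) {xs = permsByInsertion n} w∈)
        (q , _ , w≡) = ∈-map⁻ (λ q → insertAt q (suc n) π) {xs = upTo (suc n)} w∈′
        (len , range , uniq) = ∈-permsByInsertion⁻ n π∈
    in subst (IsPermutation (suc n)) (sym w≡)
         ( trans (length-insertAt q (suc n) π) (cong suc len)
         , All-insertAt q (suc n) π (s≤s z≤n , ≤-refl) (All.map (λ (1≤x , x≤n) → 1≤x , m≤n⇒m≤1+n x≤n) range)
         , insertAt-unique q (suc n) π (1+n∉ range) uniq)

  ∈-permsByInsertion⁺ : ∀ n {w} → IsPermutation n w → w ∈ permsByInsertion n
  ∈-permsByInsertion⁺ zero    {[]}    _                       = here refl
  ∈-permsByInsertion⁺ (suc n) {w}     (len , range , uniq) with suc n ∈? w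
  ... | no  n∉ = ⊥-elim (1+n≰n (subst (_≤ n) len (pigeonhole n w uniq (All-InRange-shrink n w range n∉))))
  ... | yes n∈ with removeMax n w uniq range n∈
  ...   | xs , ys , refl , uniq′ , range′ =
    ∈-concatMap⁺ (insertions n)
      (Any.map (λ { refl → subst (_∈ insertions n (xs ++ ys)) (insertAt-++ (suc n) xs ys)
                               (∈-map⁺ (λ q → insertAt q (suc n) (xs ++ ys)) (∈-upTo⁺ q<)) })
               (∈-permsByInsertion⁺ n (len′ , range′ , uniq′)))
    where
      len′ : length (xs ++ ys) ≡ n
      len′ = suc-injective (trans (sym (length-remove xs ys)) len)
      q< : length xs < suc n
      q< = s≤s (subst (length xs ≤_) len′ (length-++-≤ˡ xs))

  permsByInsertion-unique : ∀ n → Unique (permsByInsertion n)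
  permsByInsertion-unique zero    = [] ∷ []
  permsByInsertion-unique (suc n) =
    unique-concatMap (insertions n) (permsByInsertion n) (permsByInsertion-unique n)
      (λ π∈ → unique-map-on _ (upTo (suc n))
                (λ p∈ q∈ e → proj₁ (insertAt-injective _ _ _ _ _ (∉ π∈) (∉ π∈) (≤len π∈ p∈) (≤len π∈ q∈) e))
                (Unique.upTo⁺ (suc n)))
      λ π∈ σ∈ w∈π w∈σ →
        let (p , p∈ , e) = ∈-map⁻ _ w∈π
            (q , q∈ , e′) = ∈-map⁻ _ w∈σ
        in proj₂ (insertAt-injective p q _ _ _ (∉ π∈) (∉ σ∈) (≤len π∈ p∈) (≤len σ∈ q∈) (trans (sym e) e′))
    where
      ∉ : ∀ {π} → π ∈ permsByInsertion n → suc n ∉ π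
      ∉ π∈ = 1+n∉ (proj₁ (proj₂ (∈-permsByInsertion⁻ n π∈)))
      ≤len : ∀ {π q} → π ∈ permsByInsertion n → q ∈ upTo (suc n) → q ≤ length π
      ≤len π∈ q∈ = ≤-pred (subst (λ t → _ < suc t) (sym (proj₁ (∈-permsByInsertion⁻ n π∈))) (∈-upTo⁻ q∈))

  perms↭permsByInsertion : ∀ n → perms n ↭ permsByInsertion n
  perms↭permsByInsertion n = ∼bag⇒↭ (unique∧set⇒bag (perms-unique n) (permsByInsertion-unique n)
    (mk⇔ (λ p → ∈-permsByInsertion⁺ n (∈-perms⁻ n p)) (λ p → ∈-perms⁺ n (∈-permsByInsertion⁻ n p))))

  _≟ₗ_ : DecidableEquality (List ℕ)
  _≟ₗ_ = ≡-dec _≟_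

  count : List ℕ → ℕ → ℕ
  count S n = length (filter (λ π → peakSet π ≟ₗ S) (permsByInsertion n))

  countPeakSet≡count : ∀ S n → countPeakSet S n ≡ count S n
  countPeakSet≡count S n = ↭-length (filter-↭ (λ π → peakSet π ≟ₗ S) (perms↭permsByInsertion n))

  -- Peak sets under insertion of the maximum

  <ᵇ-true : ∀ {m n} → m < n → (m <ᵇ n) ≡ true
  <ᵇ-true {zero}  {suc n} _       = refl
  <ᵇ-true {suc m} {suc n} (s≤s p) = <ᵇ-true p

  <ᵇ-false : ∀ {m n} → n ≤ m → (m <ᵇ n) ≡ false
  <ᵇ-false {m}     {zero}  _       = refl
  <ᵇ-false {suc m} {suc n} (s≤s p) = <ᵇ-false p

  <ᵇ-asym : ∀ m n → (m <ᵇ n) ≡ true → (n <ᵇ m) ≡ false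
  <ᵇ-asym m n m<n = <ᵇ-false (<⇒≤ (<ᵇ⇒< m n (subst T (sym m<n) tt)))

  -- peaks are never adjacent
  Spaced : ℕ → List ℕ → Set
  Spaced i []       = ⊤
  Spaced i (x ∷ xs) = i ≤ x × Spaced (2 + x) xs

  Spaced-mono : ∀ {i j} xs → j ≤ i → Spaced i xs → Spaced j xs
  Spaced-mono []       _   _            = tt
  Spaced-mono (x ∷ xs) j≤i (i≤x , rest) = ≤-trans j≤i i≤x , rest

  Spaced⇒All≥ : ∀ {i} xs → Spaced i xs → All (i ≤_) xs
  Spaced⇒All≥ []       _            = []
  Spaced⇒All≥ (x ∷ xs) (i≤x , rest) =
    i≤x ∷ All.map (λ 2+x≤ → ≤-trans i≤x (≤-trans (n≤1+n x) (≤-trans (n≤1+n _) 2+x≤))) (Spaced⇒All≥ xs rest)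

  peaksFrom-afterDescent : ∀ x y i ws → (y <ᵇ x) ≡ true → peaksFrom x i (y ∷ ws) ≡ peaksFrom y (suc i) ws
  peaksFrom-afterDescent x y i []       _   = refl
  peaksFrom-afterDescent x y i (z ∷ ws) y<x rewrite <ᵇ-asym y x y<x = refl

  ∧-trueʳ : ∀ a {b} → a ∧ b ≡ true → b ≡ true
  ∧-trueʳ true b≡true = b≡true

  Spaced-if : ∀ b {i} R → Spaced (suc i) R → (b ≡ true → Spaced (2 + i) R) → Spaced i (if b then i ∷ R else R)
  Spaced-if true  R _       spaced = ≤-refl , spaced refl
  Spaced-if false R spaced  _      = Spaced-mono R (n≤1+n _) spaced

  peaksFrom-spaced : ∀ prev i w → Spaced i (peaksFrom prev i w)
  peaksFrom-spaced prev i []           = tt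
  peaksFrom-spaced prev i (x ∷ [])     = tt
  peaksFrom-spaced prev i (x ∷ y ∷ ws) =
    Spaced-if ((prev <ᵇ x) ∧ (y <ᵇ x)) _ (peaksFrom-spaced x (suc i) (y ∷ ws))
      λ peak → subst (Spaced (2 + i)) (sym (peaksFrom-afterDescent x y (suc i) ws (∧-trueʳ (prev <ᵇ x) peak)))
                     (peaksFrom-spaced y (2 + i) ws)

  peaksFrom-suc : ∀ prev i w → peaksFrom prev (suc i) w ≡ map suc (peaksFrom prev i w)
  peaksFrom-suc prev i []           = refl
  peaksFrom-suc prev i (x ∷ [])     = refl
  peaksFrom-suc prev i (x ∷ y ∷ ws) =
    trans (cong (λ R → if (prev <ᵇ x) ∧ (y <ᵇ x) then suc i ∷ R else R) (peaksFrom-suc x (suc i) (y ∷ ws)))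
          (sym (if-float (map suc) ((prev <ᵇ x) ∧ (y <ᵇ x))))

  All-if : ∀ {P : ℕ → Set} b {i} R → P i → All P R → All P (if b then i ∷ R else R)
  All-if true  R pi all = pi ∷ all
  All-if false R pi all = all

  peaksFrom-bounded : ∀ prev i w → All (λ z → suc z < i + length w) (peaksFrom prev i w)
  peaksFrom-bounded prev i []           = []
  peaksFrom-bounded prev i (x ∷ [])     = []
  peaksFrom-bounded prev i (x ∷ y ∷ ws) =
    All-if ((prev <ᵇ x) ∧ (y <ᵇ x)) _
      (subst (2 + i ≤_) (+-comm (length (y ∷ x ∷ ws)) i) (s≤s (s≤s (m≤n+m i (length ws)))))
      (All.map (λ {z} → subst (suc z <_) (sym (+-suc i (length (y ∷ ws))))) (peaksFrom-bounded x (suc i) (y ∷ ws)))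

  -- p is the position (counted from 1) of the new maximum, and b = false when it is the last letter
  insertMaxPeaks : ℕ → Bool → List ℕ → List ℕ
  insertMaxPeaks p b pk =
    filter (λ z → suc z <? p) pk ++ (if b then p ∷ [] else []) ++ map suc (filter (p <?_) pk)

  private
    insertMaxPeaks-skip : ∀ c i p b S → ¬ (suc i < p) → ¬ (p < i) →
                          insertMaxPeaks p b (if c then i ∷ S else S) ≡ insertMaxPeaks p b S
    insertMaxPeaks-skip true  i p b S ¬i+1<p ¬p<i =
      cong₂ (λ A C → A ++ (if b then p ∷ [] else []) ++ map suc C)
        (filter-reject (λ z → suc z <? p) ¬i+1<p) (filter-reject (p <?_) ¬p<i)
    insertMaxPeaks-skip false i p b S _ _ = refl

    insertMaxPeaks-keep : ∀ c i p b S → suc i < p →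
                          (if c then i ∷ insertMaxPeaks p b S else insertMaxPeaks p b S)
                            ≡ insertMaxPeaks p b (if c then i ∷ S else S)
    insertMaxPeaks-keep true  i p b S i+1<p =
      sym (cong₂ (λ A C → A ++ (if b then p ∷ [] else []) ++ map suc C)
            (filter-accept (λ z → suc z <? p) i+1<p)
            (filter-reject (p <?_) (λ p<i → <-irrefl refl (<-trans (n<1+n i) (<-trans i+1<p p<i)))))
    insertMaxPeaks-keep false i p b S _ = refl

    filter->-if : ∀ c i S → All (suc i ≤_) S → filter (i <?_) (if c then i ∷ S else S) ≡ S
    filter->-if true  i S all = trans (filter-reject (i <?_) (<-irrefl refl)) (filter-all (i <?_) all)
    filter->-if false i S all = filter-all (i <?_) all

  peaksFrom-insertAt : ∀ q prev i b π → prev < b → All (_< b) π → q ≤ length π →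
                       peaksFrom prev i (insertAt q b π)
                         ≡ insertMaxPeaks (q + i) (q <ᵇ length π) (peaksFrom prev i π)
  peaksFrom-insertAt zero prev i b [] _ _ _ = refl
  peaksFrom-insertAt zero prev i b (x ∷ []) prev<b (x<b ∷ []) _
    rewrite <ᵇ-true prev<b | <ᵇ-true x<b = refl
  peaksFrom-insertAt zero prev i b (x ∷ y ∷ ws) prev<b (x<b ∷ _) _
    rewrite <ᵇ-true prev<b | <ᵇ-true x<b | <ᵇ-false (<⇒≤ x<b) =
    sym (trans (cong₂ (λ A C → A ++ i ∷ map suc C)
                  (filter-none (λ z → suc z <? i)
                    (All.map (λ i≤z z+1<i → <-irrefl refl (≤-<-trans i≤z (<-trans (n<1+n _) z+1<i)))
                             (Spaced⇒All≥ _ (peaksFrom-spaced prev i (x ∷ y ∷ ws)))))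
                  (filter->-if ((prev <ᵇ x) ∧ (y <ᵇ x)) i _ (Spaced⇒All≥ _ (peaksFrom-spaced x (suc i) (y ∷ ws)))))
               (cong (i ∷_) (sym (peaksFrom-suc x (suc i) (y ∷ ws)))))
  peaksFrom-insertAt (suc q) prev i b [] _ _ _ = refl
  peaksFrom-insertAt (suc zero) prev i b (x ∷ []) _ (x<b ∷ []) _
    rewrite <ᵇ-false (<⇒≤ x<b) | ∧-zeroʳ (prev <ᵇ x) = refl
  peaksFrom-insertAt (suc zero) prev i b (x ∷ y ∷ ws) _ (x<b ∷ y∷ws<b) _
    rewrite <ᵇ-false (<⇒≤ x<b) | ∧-zeroʳ (prev <ᵇ x) =
    trans (peaksFrom-insertAt zero x (suc i) b (y ∷ ws) x<b y∷ws<b z≤n)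
          (sym (insertMaxPeaks-skip ((prev <ᵇ x) ∧ (y <ᵇ x)) i (suc i) true (peaksFrom x (suc i) (y ∷ ws))
                  (<-irrefl refl) (λ i+1<i → <-irrefl refl (<-trans i+1<i (n<1+n i)))))
  peaksFrom-insertAt (suc (suc q)) prev i b (x ∷ []) _ _ (s≤s ())
  peaksFrom-insertAt (suc (suc q)) prev i b (x ∷ y ∷ ws) _ (x<b ∷ y∷ws<b) (s≤s q≤) =
    trans (cong (λ R → if (prev <ᵇ x) ∧ (y <ᵇ x) then i ∷ R else R)
             (trans (peaksFrom-insertAt (suc q) x (suc i) b (y ∷ ws) x<b y∷ws<b q≤)
                    (cong (λ p → insertMaxPeaks p (suc q <ᵇ length (y ∷ ws)) (peaksFrom x (suc i) (y ∷ ws)))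
                          (cong suc (+-suc q i)))))
          (insertMaxPeaks-keep ((prev <ᵇ x) ∧ (y <ᵇ x)) i (2 + q + i) (suc q <ᵇ length (y ∷ ws))
             (peaksFrom x (suc i) (y ∷ ws)) (s≤s (s≤s (m≤n+m i q))))

  -- Finite sums of natural numbers

  ∑ : ∀ {A : Set} → List A → (A → ℕ) → ℕ
  ∑ []       f = 0
  ∑ (x ∷ xs) f = f x + ∑ xs f

  syntax ∑ xs (λ x → e) = ∑[ x ∈ xs ] e

  𝟙 : ∀ {P : Set} → Dec P → ℕ
  𝟙 (yes _) = 1
  𝟙 (no _)  = 0

  module _ {A : Set} where

    ∑-cong : ∀ xs {f g : A → ℕ} → (∀ {x} → x ∈ xs → f x ≡ g x) → ∑ xs f ≡ ∑ xs g
    ∑-cong []       _   = refl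
    ∑-cong (x ∷ xs) f≗g = cong₂ _+_ (f≗g (here refl)) (∑-cong xs (λ p → f≗g (there p)))

    ∑-zero : ∀ xs {f : A → ℕ} → (∀ {x} → x ∈ xs → f x ≡ 0) → ∑ xs f ≡ 0
    ∑-zero []       _  = refl
    ∑-zero (x ∷ xs) f≗0 rewrite f≗0 (here refl) = ∑-zero xs (λ p → f≗0 (there p))

    ∑-++ : ∀ xs ys (f : A → ℕ) → ∑ (xs ++ ys) f ≡ ∑ xs f + ∑ ys f
    ∑-++ []       ys f = refl
    ∑-++ (x ∷ xs) ys f rewrite ∑-++ xs ys f = sym (+-assoc (f x) (∑ xs f) (∑ ys f))

    ∑-+ : ∀ xs (f g : A → ℕ) → ∑[ x ∈ xs ] (f x + g x) ≡ ∑ xs f + ∑ xs g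
    ∑-+ []       f g = refl
    ∑-+ (x ∷ xs) f g rewrite ∑-+ xs f g = +-interchange (f x) (g x) (∑ xs f) (∑ xs g)

    ∑-*ʳ : ∀ xs (f : A → ℕ) c → ∑[ x ∈ xs ] (f x * c) ≡ ∑ xs f * c
    ∑-*ʳ []       f c = refl
    ∑-*ʳ (x ∷ xs) f c rewrite ∑-*ʳ xs f c = sym (*-distribʳ-+ c (f x) (∑ xs f))

    length-filter : ∀ {P : Pred A _} (P? : Decidable P) xs → length (filter P? xs) ≡ ∑[ x ∈ xs ] 𝟙 (P? x)
    length-filter P? []       = refl
    length-filter P? (x ∷ xs) with P? x
    ... | yes _ = cong suc (length-filter P? xs)
    ... | no  _ = length-filter P? xs

  module _ {A B : Set} where

    ∑-map : ∀ (g : A → B) xs (f : B → ℕ) → ∑ (map g xs) f ≡ ∑[ x ∈ xs ] f (g x)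
    ∑-map g []       f = refl
    ∑-map g (x ∷ xs) f = cong (f (g x) +_) (∑-map g xs f)

    ∑-concatMap : ∀ (g : A → List B) xs (f : B → ℕ) → ∑ (concatMap g xs) f ≡ ∑[ x ∈ xs ] ∑ (g x) f
    ∑-concatMap g []       f = refl
    ∑-concatMap g (x ∷ xs) f = trans (∑-++ (g x) (concatMap g xs) f) (cong (∑ (g x) f +_) (∑-concatMap g xs f))

    ∑-comm : ∀ xs ys (f : A → B → ℕ) → ∑[ x ∈ xs ] ∑[ y ∈ ys ] f x y ≡ ∑[ y ∈ ys ] ∑[ x ∈ xs ] f x y
    ∑-comm []       ys f = sym (∑-zero ys (λ _ → refl))
    ∑-comm (x ∷ xs) ys f = trans (cong (∑ ys (f x) +_) (∑-comm xs ys f)) (sym (∑-+ ys (f x) _))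

  𝟙-yes : ∀ {P : Set} → P → (p : Dec P) → 𝟙 p ≡ 1
  𝟙-yes p (yes _) = refl
  𝟙-yes p (no ¬p) = ⊥-elim (¬p p)

  𝟙-no : ∀ {P : Set} → ¬ P → (p : Dec P) → 𝟙 p ≡ 0
  𝟙-no ¬p (yes p) = ⊥-elim (¬p p)
  𝟙-no ¬p (no _)  = refl

  module _ {A : Set} (_≟_ : DecidableEquality A) where

    ∑-𝟙≟-∉ : ∀ x ys → x ∉ ys → ∑[ y ∈ ys ] 𝟙 (x ≟ y) ≡ 0
    ∑-𝟙≟-∉ x ys x∉ = ∑-zero ys (λ y∈ → 𝟙-no (λ { refl → x∉ y∈ }) (x ≟ _))

    ∑-𝟙≟-∈ : ∀ x ys → Unique ys → x ∈ ys → ∑[ y ∈ ys ] 𝟙 (x ≟ y) ≡ 1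
    ∑-𝟙≟-∈ x (y ∷ ys) (y∉ ∷ _) (here refl) with x ≟ x
    ... | yes _   = cong suc (∑-𝟙≟-∉ x ys (λ x∈ → All.lookup y∉ x∈ refl))
    ... | no  x≢x = ⊥-elim (x≢x refl)
    ∑-𝟙≟-∈ x (y ∷ ys) (y∉ ∷ uys) (there x∈) with x ≟ y
    ... | yes refl = ⊥-elim (All.lookup y∉ x∈ refl)
    ... | no  _    = ∑-𝟙≟-∈ x ys uys x∈

    𝟙-∈ : ∀ {P : Set} (P? : Dec P) x ys → Unique ys → P ⇔ x ∈ ys → 𝟙 P? ≡ ∑[ y ∈ ys ] 𝟙 (x ≟ y)
    𝟙-∈ P? x ys uys P⇔∈ with Any.any? (x ≟_) ys
    ... | yes x∈ = trans (𝟙-yes (Equivalence.from P⇔∈ x∈) P?) (sym (∑-𝟙≟-∈ x ys uys x∈))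
    ... | no  x∉ = trans (𝟙-no (λ p → x∉ (Equivalence.to P⇔∈ p)) P?) (sym (∑-𝟙≟-∉ x ys x∉))

    -- The proof writes both sides as ∑ over xs × ps of [q = p] f q.
    ∑-support : ∀ xs ps (f : A → ℕ) → Unique xs → Unique ps → (∀ {p} → p ∈ ps → p ∈ xs) →
                (∀ {q} → q ∈ xs → q ∉ ps → f q ≡ 0) → ∑ xs f ≡ ∑ ps f
    ∑-support xs ps f uxs ups ps⊆xs outside = begin
        ∑ xs f                                      ≡⟨ ∑-cong xs spread ⟩
        ∑[ q ∈ xs ] ∑[ p ∈ ps ] (𝟙 (q ≟ p) * f q)   ≡⟨ ∑-comm xs ps _ ⟩
        ∑[ p ∈ ps ] ∑[ q ∈ xs ] (𝟙 (q ≟ p) * f q)   ≡⟨ ∑-cong ps (λ p∈ → collect (ps⊆xs p∈)) ⟩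
        ∑ ps f                                      ∎
      where
        spread : ∀ {q} → q ∈ xs → f q ≡ ∑[ p ∈ ps ] (𝟙 (q ≟ p) * f q)
        spread {q} q∈ with Any.any? (q ≟_) ps
        ... | yes q∈ps = sym (begin
          ∑[ p ∈ ps ] (𝟙 (q ≟ p) * f q) ≡⟨ ∑-*ʳ ps _ (f q) ⟩
          (∑[ p ∈ ps ] 𝟙 (q ≟ p)) * f q ≡⟨ cong (_* f q) (∑-𝟙≟-∈ q ps ups q∈ps) ⟩
          1 * f q                       ≡⟨ *-identityˡ (f q) ⟩
          f q                           ∎)
        ... | no  q∉ps = sym (begin
          ∑[ p ∈ ps ] (𝟙 (q ≟ p) * f q) ≡⟨ ∑-*ʳ ps _ (f q) ⟩
          (∑[ p ∈ ps ] 𝟙 (q ≟ p)) * f q ≡⟨ cong (_* f q) (∑-𝟙≟-∉ q ps q∉ps) ⟩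
          0                             ≡⟨ sym (outside q∈ q∉ps) ⟩
          f q                           ∎)

        𝟙-flip : ∀ p q → 𝟙 (q ≟ p) * f q ≡ 𝟙 (p ≟ q) * f p
        𝟙-flip p q with q ≟ p | p ≟ q
        ... | yes refl | yes _    = refl
        ... | no  _    | no  _    = refl
        ... | yes refl | no  p≢p  = ⊥-elim (p≢p refl)
        ... | no  q≢p  | yes refl = ⊥-elim (q≢p refl)

        collect : ∀ {p} → p ∈ xs → ∑[ q ∈ xs ] (𝟙 (q ≟ p) * f q) ≡ f p
        collect {p} p∈ = begin
          ∑[ q ∈ xs ] (𝟙 (q ≟ p) * f q) ≡⟨ ∑-cong xs (λ {q} _ → 𝟙-flip p q) ⟩
          ∑[ q ∈ xs ] (𝟙 (p ≟ q) * f p) ≡⟨ ∑-*ʳ xs _ (f p) ⟩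
          (∑[ q ∈ xs ] 𝟙 (p ≟ q)) * f p ≡⟨ cong (_* f p) (∑-𝟙≟-∈ p xs uxs p∈) ⟩
          1 * f p                       ≡⟨ *-identityˡ (f p) ⟩
          f p                           ∎

  -- Counting permutations by peak set

  newPeaks : ℕ → ℕ → List ℕ → List ℕ
  newPeaks q L pk = insertMaxPeaks (suc q) (q <ᵇ L) pk

  #insertions : List ℕ → ℕ → List ℕ → ℕ
  #insertions S L pk = ∑[ q ∈ upTo (suc L) ] 𝟙 (newPeaks q L pk ≟ₗ S)

  ValidPeakSet : ℕ → List ℕ → Set
  ValidPeakSet L pk = Spaced 1 pk × All (_< L) pk

  peakSet-valid : ∀ {L π} → π ∈ permsByInsertion L → ValidPeakSet L (peakSet π)
  peakSet-valid {L} {π} π∈ with ∈-permsByInsertion⁻ L π∈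
  ... | refl , _ = peaksFrom-spaced 0 1 π , All.map ≤-pred (peaksFrom-bounded 0 1 π)

  peakSet-insertAt : ∀ {L π q} → π ∈ permsByInsertion L → q < suc L →
                     peakSet (insertAt q (suc L) π) ≡ newPeaks q L (peakSet π)
  peakSet-insertAt {L} {π} {q} π∈ q<1+L with ∈-permsByInsertion⁻ L π∈
  ... | refl , range , _ =
    trans (peaksFrom-insertAt q 0 1 (suc L) π (s≤s z≤n) (All.map (λ (_ , x≤L) → s≤s x≤L) range) (≤-pred q<1+L))
          (cong (λ p → insertMaxPeaks p (q <ᵇ length π) (peakSet π)) (+-comm q 1))

  count≡∑ : ∀ S L → count S L ≡ ∑[ π ∈ permsByInsertion L ] 𝟙 (peakSet π ≟ₗ S)
  count≡∑ S L = length-filter (λ π → peakSet π ≟ₗ S) (permsByInsertion L)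

  count-suc : ∀ S L → count S (suc L) ≡ ∑[ π ∈ permsByInsertion L ] #insertions S L (peakSet π)
  count-suc S L = begin
    count S (suc L)
      ≡⟨ count≡∑ S (suc L) ⟩
    ∑[ w ∈ permsByInsertion (suc L) ] 𝟙 (peakSet w ≟ₗ S)
      ≡⟨ ∑-concatMap (insertions L) (permsByInsertion L) _ ⟩
    ∑[ π ∈ permsByInsertion L ] ∑[ w ∈ insertions L π ] 𝟙 (peakSet w ≟ₗ S)
      ≡⟨ ∑-cong (permsByInsertion L) (λ {π} π∈ →
           trans (∑-map _ (upTo (suc L)) _)
                 (∑-cong (upTo (suc L)) (λ q∈ → cong (λ pk → 𝟙 (pk ≟ₗ S)) (peakSet-insertAt π∈ (∈-upTo⁻ q∈))))) ⟩
    ∑[ π ∈ permsByInsertion L ] #insertions S L (peakSet π)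
      ∎

  count-recurrence : ∀ S L (Ts : List (List ℕ)) →
                     (∀ pk → ValidPeakSet L pk → #insertions S L pk ≡ ∑[ T ∈ Ts ] 𝟙 (pk ≟ₗ T)) →
                     count S (suc L) ≡ ∑[ T ∈ Ts ] count T L
  count-recurrence S L Ts #insertions≡ = begin
    count S (suc L)
      ≡⟨ count-suc S L ⟩
    ∑[ π ∈ permsByInsertion L ] #insertions S L (peakSet π)
      ≡⟨ ∑-cong (permsByInsertion L) (λ π∈ → #insertions≡ _ (peakSet-valid π∈)) ⟩
    ∑[ π ∈ permsByInsertion L ] ∑[ T ∈ Ts ] 𝟙 (peakSet π ≟ₗ T)
      ≡⟨ ∑-comm (permsByInsertion L) Ts _ ⟩
    ∑[ T ∈ Ts ] ∑[ π ∈ permsByInsertion L ] 𝟙 (peakSet π ≟ₗ T)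
      ≡⟨ ∑-cong Ts (λ {T} _ → sym (count≡∑ T L)) ⟩
    ∑[ T ∈ Ts ] count T L
      ∎

  count-impossible : ∀ S L → (∀ pk → ValidPeakSet L pk → pk ≢ S) → count S L ≡ 0
  count-impossible S L invalid =
    trans (count≡∑ S L) (∑-zero (permsByInsertion L) (λ π∈ → 𝟙-no (invalid _ (peakSet-valid π∈)) _))

  below above : ℕ → List ℕ → List ℕ
  below q = filter (λ z → suc z <? suc q)
  above q = filter (suc q <?_)

  newPeaks-inner : ∀ q L pk → q < L → newPeaks q L pk ≡ below q pk ++ suc q ∷ map suc (above q pk)
  newPeaks-inner q L pk q<L rewrite <ᵇ-true q<L = refl

  newPeaks-last : ∀ L pk → All (_< L) pk → newPeaks L L pk ≡ pk
  newPeaks-last L pk pk<L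
    rewrite <ᵇ-false (≤-refl {L})
          | filter-all (λ z → suc z <? suc L) (All.map s≤s pk<L)
          | filter-none (suc L <?_) (All.map (λ z<L L+1<z → <-irrefl refl (<-trans z<L (<-trans (n<1+n L) L+1<z))) pk<L)
    = ++-identityʳ pk

  -- Only the positions q with q + 1 ∈ S, and the final position L, can produce S.
  #insertions-support : ∀ Q L pk → Unique Q → All (_< L) Q → All (_< L) pk →
                        #insertions (map suc Q) L pk
                          ≡ ∑[ q ∈ Q ] 𝟙 (newPeaks q L pk ≟ₗ map suc Q) + 𝟙 (pk ≟ₗ map suc Q)
  #insertions-support Q L pk uQ Q<L pk<L = begin
    #insertions S L pk
      ≡⟨ ∑-support _≟_ (upTo (suc L)) (Q ++ L ∷ []) f (Unique.upTo⁺ (suc L)) uQL QL⊆ outside ⟩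
    ∑ (Q ++ L ∷ []) f
      ≡⟨ ∑-++ Q (L ∷ []) f ⟩
    ∑ Q f + (f L + 0)
      ≡⟨ cong (λ t → ∑ Q f + t) (trans (+-identityʳ (f L)) (cong (λ pk′ → 𝟙 (pk′ ≟ₗ S)) (newPeaks-last L pk pk<L))) ⟩
    ∑ Q f + 𝟙 (pk ≟ₗ S)
      ∎
    where
      S = map suc Q
      f = λ q → 𝟙 (newPeaks q L pk ≟ₗ S)
      uQL : Unique (Q ++ L ∷ [])
      uQL = Unique.++⁺ uQ ([] ∷ []) (λ { (q∈ , here q≡L) → <-irrefl q≡L (All.lookup Q<L q∈) })
      QL⊆ : ∀ {q} → q ∈ Q ++ L ∷ [] → q ∈ upTo (suc L)
      QL⊆ q∈ with ∈-++⁻ Q q∈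
      ... | inj₁ q∈Q       = ∈-upTo⁺ (<-trans (All.lookup Q<L q∈Q) (n<1+n L))
      ... | inj₂ (here refl) = ∈-upTo⁺ (n<1+n L)
      outside : ∀ {q} → q ∈ upTo (suc L) → q ∉ Q ++ L ∷ [] → f q ≡ 0
      outside {q} q∈ q∉ = 𝟙-no (λ new≡S → q∉Q (∈-map-suc⁻ (subst (suc q ∈_) new≡S new∋))) _
        where
          q<L : q < L
          q<L = ≤∧≢⇒< (≤-pred (∈-upTo⁻ q∈)) (λ q≡L → q∉ (∈-++⁺ʳ Q (here q≡L)))
          q∉Q : q ∉ Q
          q∉Q q∈Q = q∉ (∈-++⁺ˡ q∈Q)
          new∋ : suc q ∈ newPeaks q L pk
          new∋ rewrite newPeaks-inner q L pk q<L = ∈-++⁺ʳ (below q pk) (here refl)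
          ∈-map-suc⁻ : suc q ∈ map suc Q → q ∈ Q
          ∈-map-suc⁻ q+1∈ with ∈-map⁻ suc q+1∈
          ... | _ , p∈ , refl = p∈

  count-suc-byPositions : ∀ Q L (Ts : ℕ → List (List ℕ)) → Unique Q → All (_< L) Q →
    (∀ {q} → q ∈ Q → Unique (Ts q) × (∀ pk → ValidPeakSet L pk → newPeaks q L pk ≡ map suc Q ⇔ pk ∈ Ts q)) →
    count (map suc Q) (suc L) ≡ ∑[ q ∈ Q ] ∑[ T ∈ Ts q ] count T L + (count (map suc Q) L + 0)
  count-suc-byPositions Q L Ts uQ Q<L preimage = begin
    count S (suc L)
      ≡⟨ count-recurrence S L (concatMap Ts Q ++ S ∷ []) #insertions≡ ⟩
    ∑[ T ∈ concatMap Ts Q ++ S ∷ [] ] count T L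
      ≡⟨ ∑-++ (concatMap Ts Q) (S ∷ []) _ ⟩
    ∑[ T ∈ concatMap Ts Q ] count T L + (count S L + 0)
      ≡⟨ cong (_+ (count S L + 0)) (∑-concatMap Ts Q _) ⟩
    ∑[ q ∈ Q ] ∑[ T ∈ Ts q ] count T L + (count S L + 0)
      ∎
    where
      S = map suc Q
      #insertions≡ : ∀ pk → ValidPeakSet L pk → #insertions S L pk ≡ ∑[ T ∈ concatMap Ts Q ++ S ∷ [] ] 𝟙 (pk ≟ₗ T)
      #insertions≡ pk valid@(_ , pk<L) = begin
        #insertions S L pk
          ≡⟨ #insertions-support Q L pk uQ Q<L pk<L ⟩
        ∑[ q ∈ Q ] 𝟙 (newPeaks q L pk ≟ₗ S) + 𝟙 (pk ≟ₗ S)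
          ≡⟨ cong (_+ 𝟙 (pk ≟ₗ S)) (∑-cong Q (λ q∈ →
               𝟙-∈ _≟ₗ_ (newPeaks _ L pk ≟ₗ S) pk _ (proj₁ (preimage q∈)) (proj₂ (preimage q∈) pk valid))) ⟩
        ∑[ q ∈ Q ] ∑[ T ∈ Ts q ] 𝟙 (pk ≟ₗ T) + 𝟙 (pk ≟ₗ S)
          ≡⟨ cong₂ _+_ (sym (∑-concatMap Ts Q _)) (sym (+-identityʳ _)) ⟩
        ∑[ T ∈ concatMap Ts Q ] 𝟙 (pk ≟ₗ T) + (𝟙 (pk ≟ₗ S) + 0)
          ≡⟨ sym (∑-++ (concatMap Ts Q) (S ∷ []) _) ⟩
        ∑[ T ∈ concatMap Ts Q ++ S ∷ [] ] 𝟙 (pk ≟ₗ T)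
          ∎

  -- Preimages of {k} and {1, m} under insertion

  filter≡[]⇒All∁ : ∀ {P : ℕ → Set} (P? : Decidable P) xs → filter P? xs ≡ [] → All (∁ P) xs
  filter≡[]⇒All∁ P? xs none = All.tabulate λ x∈ px → case subst (_ ∈_) none (∈-filter⁺ P? x∈ px) of λ ()

  below⇒≥ : ∀ q pk → below q pk ≡ [] → All (q ≤_) pk
  below⇒≥ q pk none = All.map (λ ¬z<q → ≤-pred (≮⇒≥ ¬z<q)) (filter≡[]⇒All∁ (λ z → suc z <? suc q) pk none)

  above⇒≤ : ∀ q pk → map suc (above q pk) ≡ [] → All (_≤ suc q) pk
  above⇒≤ q pk none = All.map ≮⇒≥ (filter≡[]⇒All∁ (suc q <?_) pk (map-injective suc-injective none))

  ++-∷≡single : ∀ (A C : List ℕ) x → A ++ x ∷ C ≡ x ∷ [] → A ≡ [] × C ≡ []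
  ++-∷≡single []          C x e  = refl , proj₂ (∷-injective e)
  ++-∷≡single (a ∷ [])    C x ()
  ++-∷≡single (a ∷ b ∷ A) C x ()

  ++-∷≡pair : ∀ (A C : List ℕ) y x → y ≢ x → A ++ x ∷ C ≡ y ∷ x ∷ [] → A ≡ y ∷ [] × C ≡ []
  ++-∷≡pair []              C y x y≢x e = ⊥-elim (y≢x (sym (proj₁ (∷-injective e))))
  ++-∷≡pair (a ∷ [])        C y x y≢x e with ∷-injective e
  ... | refl , e′ = refl , proj₂ (∷-injective e′)
  ++-∷≡pair (a ∷ b ∷ [])    C y x y≢x ()
  ++-∷≡pair (a ∷ b ∷ c ∷ A) C y x y≢x ()

  Spaced-within : ∀ {j} k pk → Spaced j pk → All (k ≤_) pk → All (_≤ suc k) pk →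
                  pk ∈ ([] ∷ (k ∷ []) ∷ (suc k ∷ []) ∷ [])
  Spaced-within k []      _ _ _ = here refl
  Spaced-within k (x ∷ []) _ (k≤x ∷ []) (x≤k+1 ∷ []) with x ≟ k
  ... | yes refl = there (here refl)
  ... | no  x≢k  = there (there (here (cong (_∷ []) (≤-antisym x≤k+1 (≤∧≢⇒< k≤x (λ e → x≢k (sym e)))))))
  Spaced-within k (x ∷ y ∷ _) (_ , x+2≤y , _) (k≤x ∷ _) (_ ∷ y≤k+1 ∷ _) =
    ⊥-elim (≤⇒≯ y≤k+1 (≤-trans (s≤s (s≤s k≤x)) x+2≤y))

  Spaced-filter>1 : ∀ pk ys → Spaced 1 pk → filter (1 <?_) pk ≡ ys → pk ∈ (ys ∷ (1 ∷ ys) ∷ [])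
  Spaced-filter>1 []                     ys _           refl = here refl
  Spaced-filter>1 (suc zero ∷ rest)      ys (_ , rest≥3) refl =
    there (here (cong (1 ∷_) (sym (filter-all (1 <?_) {xs = rest} (All.map (≤-trans (s≤s (s≤s z≤n))) (Spaced⇒All≥ rest rest≥3))))))
  Spaced-filter>1 (suc (suc x) ∷ rest)   ys (_ , rest≥) refl =
    here (sym (trans (filter-accept (1 <?_) {xs = rest} (s≤s (s≤s z≤n)))
                     (cong (suc (suc x) ∷_)
                           (filter-all (1 <?_) {xs = rest} (All.map (≤-trans (s≤s (s≤s z≤n))) (Spaced⇒All≥ rest rest≥))))))

  Spaced-below≡[1] : ∀ m pk → Spaced 1 pk → below m pk ≡ 1 ∷ [] → All (_≤ suc m) pk →
                       pk ∈ ((1 ∷ []) ∷ (1 ∷ m ∷ []) ∷ (1 ∷ suc m ∷ []) ∷ [])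
  Spaced-below≡[1] m []         _                  () _
  Spaced-below≡[1] m (x ∷ rest) (_ , rest-spaced) below (_ ∷ rest≤) with suc x <? suc m
  ... | yes x<m with ∷-injective (trans (sym (filter-accept (λ z → suc z <? suc m) {xs = rest} x<m)) below)
  ...   | refl , rest-below≡[] =
    ∈-map⁺ (1 ∷_) (Spaced-within m rest rest-spaced (below⇒≥ m rest rest-below≡[]) rest≤)
  Spaced-below≡[1] m (x ∷ rest) (_ , rest-spaced) below _ | no x≮m =
    case trans (sym below) (trans (filter-reject (λ z → suc z <? suc m) {xs = rest} x≮m) (filter-none (λ z → suc z <? suc m)
           (All.map (λ x+2≤z z<m → <-asym (≤-trans (≤-pred z<m) (≤-pred (≮⇒≥ x≮m))) (≤-trans (n≤1+n _) x+2≤z))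
                    (Spaced⇒All≥ rest rest-spaced))))
    of λ ()

  newPeaks-[k+1]⁻ : ∀ k L pk → k < L → Spaced 1 pk → newPeaks k L pk ≡ suc k ∷ [] →
                    pk ∈ ([] ∷ (k ∷ []) ∷ (suc k ∷ []) ∷ [])
  newPeaks-[k+1]⁻ k L pk k<L spaced new≡
    with ++-∷≡single (below k pk) (map suc (above k pk)) (suc k) (trans (sym (newPeaks-inner k L pk k<L)) new≡)
  ... | below≡[] , above≡[] = Spaced-within k pk spaced (below⇒≥ k pk below≡[]) (above⇒≤ k pk above≡[])

  newPeaks-[k+1]⁺ : ∀ k L {pk} → k < L → pk ∈ ([] ∷ (k ∷ []) ∷ (suc k ∷ []) ∷ []) → newPeaks k L pk ≡ suc k ∷ []
  newPeaks-[k+1]⁺ k L k<L (here refl) = newPeaks-inner k L [] k<L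
  newPeaks-[k+1]⁺ k L k<L (there (here refl))
    rewrite newPeaks-inner k L (k ∷ []) k<L
          | filter-reject (λ z → suc z <? suc k) {xs = []} (<-irrefl refl)
          | filter-reject (suc k <?_) {xs = []} (λ k+1<k → <-asym k+1<k (n<1+n k)) = refl
  newPeaks-[k+1]⁺ k L k<L (there (there (here refl)))
    rewrite newPeaks-inner k L (suc k ∷ []) k<L
          | filter-reject (λ z → suc z <? suc k) {xs = []} (λ k+2<k+1 → <-asym k+2<k+1 (n<1+n (suc k)))
          | filter-reject (suc k <?_) {xs = []} (<-irrefl refl) = refl
  newPeaks-[k+1]⁺ k L k<L (there (there (there ())))

  newPeaks-first : ∀ L pk → newPeaks 0 (suc L) pk ≡ 1 ∷ map suc (filter (1 <?_) pk)
  newPeaks-first L pk rewrite filter-none (λ z → suc z <? 1) {xs = pk} (All.tabulate λ _ → λ { (s≤s ()) }) = refl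

  newPeaks-[1,m+1]-first⁻ : ∀ m L pk → Spaced 1 pk → newPeaks 0 (suc L) pk ≡ 1 ∷ suc m ∷ [] →
                            pk ∈ ((m ∷ []) ∷ (1 ∷ m ∷ []) ∷ [])
  newPeaks-[1,m+1]-first⁻ m L pk spaced new≡ =
    Spaced-filter>1 pk (m ∷ []) spaced
      (map-injective suc-injective (proj₂ (∷-injective (trans (sym (newPeaks-first L pk)) new≡))))

  newPeaks-[1,m+1]-first⁺ : ∀ m L {pk} → 1 < m → pk ∈ ((m ∷ []) ∷ (1 ∷ m ∷ []) ∷ []) →
                            newPeaks 0 (suc L) pk ≡ 1 ∷ suc m ∷ []
  newPeaks-[1,m+1]-first⁺ m L 1<m (here refl)
    rewrite newPeaks-first L (m ∷ []) | filter-accept (1 <?_) {xs = []} 1<m = refl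
  newPeaks-[1,m+1]-first⁺ m L 1<m (there (here refl))
    rewrite newPeaks-first L (1 ∷ m ∷ [])
          | filter-reject (1 <?_) {xs = m ∷ []} (<-irrefl refl)
          | filter-accept (1 <?_) {xs = []} 1<m = refl
  newPeaks-[1,m+1]-first⁺ m L 1<m (there (there ()))

  newPeaks-[1,m+1]-at⁻ : ∀ m L pk → 1 < m → m < L → Spaced 1 pk → newPeaks m L pk ≡ 1 ∷ suc m ∷ [] →
                         pk ∈ ((1 ∷ []) ∷ (1 ∷ m ∷ []) ∷ (1 ∷ suc m ∷ []) ∷ [])
  newPeaks-[1,m+1]-at⁻ m L pk 1<m m<L spaced new≡
    with ++-∷≡pair (below m pk) (map suc (above m pk)) 1 (suc m) (λ 1≡m+1 → <-irrefl (suc-injective 1≡m+1) (<-trans (s≤s z≤n) 1<m))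
                    (trans (sym (newPeaks-inner m L pk m<L)) new≡)
  ... | below≡[1] , above≡[] = Spaced-below≡[1] m pk spaced below≡[1] (above⇒≤ m pk above≡[])

  newPeaks-[1,m+1]-at⁺ : ∀ m L {pk} → 1 < m → m < L → pk ∈ ((1 ∷ []) ∷ (1 ∷ m ∷ []) ∷ (1 ∷ suc m ∷ []) ∷ []) →
                         newPeaks m L pk ≡ 1 ∷ suc m ∷ []
  newPeaks-[1,m+1]-at⁺ m L 1<m m<L (here refl)
    rewrite newPeaks-inner m L (1 ∷ []) m<L
          | filter-accept (λ z → suc z <? suc m) {xs = []} (s≤s 1<m) = refl
  newPeaks-[1,m+1]-at⁺ m L 1<m m<L (there (here refl))
    rewrite newPeaks-inner m L (1 ∷ m ∷ []) m<L
          | filter-accept (λ z → suc z <? suc m) {xs = m ∷ []} (s≤s 1<m)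
          | filter-reject (λ z → suc z <? suc m) {xs = []} (<-irrefl refl)
          | filter-reject (suc m <?_) {xs = []} (λ m+1<m → <-asym m+1<m (n<1+n m)) = refl
  newPeaks-[1,m+1]-at⁺ m L 1<m m<L (there (there (here refl)))
    rewrite newPeaks-inner m L (1 ∷ suc m ∷ []) m<L
          | filter-accept (λ z → suc z <? suc m) {xs = suc m ∷ []} (s≤s 1<m)
          | filter-reject (λ z → suc z <? suc m) {xs = []} (λ m+2<m+1 → <-asym m+2<m+1 (n<1+n (suc m)))
          | filter-reject (suc m <?_) {xs = []} (<-irrefl refl) = refl
  newPeaks-[1,m+1]-at⁺ m L 1<m m<L (there (there (there ())))

  count-[] : ∀ L → count [] L ≡ 1
  count-[] zero    = refl
  count-[] (suc L) = begin
    count [] (suc L)    ≡⟨ count-suc-byPositions [] L (λ _ → []) [] [] (λ ()) ⟩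
    count [] L + 0      ≡⟨ +-identityʳ _ ⟩
    count [] L          ≡⟨ count-[] L ⟩
    1                   ∎

  count-[k+1]-suc : ∀ k L → k < L →
    count (suc k ∷ []) (suc L) ≡ count [] L + count (k ∷ []) L + 2 * count (suc k ∷ []) L
  count-[k+1]-suc k L k<L = begin
    count (suc k ∷ []) (suc L)
      ≡⟨ count-suc-byPositions (k ∷ []) L (λ _ → [] ∷ (k ∷ []) ∷ (suc k ∷ []) ∷ []) ([] ∷ []) (k<L ∷ [])
           (λ { (here refl) → distinct , λ pk (spaced , _) →
                  mk⇔ (newPeaks-[k+1]⁻ k L pk k<L spaced) (newPeaks-[k+1]⁺ k L k<L) }) ⟩
    (c₀ + (cₖ + (cₖ₊₁ + 0)) + 0) + (cₖ₊₁ + 0)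
      ≡⟨ solve 3 (λ a b c → (a :+ (b :+ (c :+ con 0)) :+ con 0) :+ (c :+ con 0) := a :+ b :+ con 2 :* c) refl c₀ cₖ cₖ₊₁ ⟩
    c₀ + cₖ + 2 * cₖ₊₁
      ∎
    where
      c₀ = count [] L
      cₖ = count (k ∷ []) L
      cₖ₊₁ = count (suc k ∷ []) L
      distinct : Unique ([] ∷ (k ∷ []) ∷ (suc k ∷ []) ∷ [])
      distinct = ((λ ()) ∷ (λ ()) ∷ []) ∷ ((λ ()) ∷ []) ∷ [] ∷ []

  count-[1,m+1]-suc : ∀ m L → 2 ≤ m → m < L →
    count (1 ∷ suc m ∷ []) (suc L)
      ≡ count (m ∷ []) L + 2 * count (1 ∷ m ∷ []) L + count (1 ∷ []) L + 2 * count (1 ∷ suc m ∷ []) L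
  count-[1,m+1]-suc zero          _ ()         _
  count-[1,m+1]-suc (suc zero)    _ (s≤s ())   _
  count-[1,m+1]-suc (suc (suc _)) zero _       ()
  count-[1,m+1]-suc m@(suc (suc _)) L@(suc L′) 2≤m m<L = begin
    count (1 ∷ suc m ∷ []) (suc L)
      ≡⟨ count-suc-byPositions (0 ∷ m ∷ []) L Ts distinctQ (s≤s z≤n ∷ m<L ∷ [])
           (λ { (here refl) → distinct₀ , λ pk (spaced , _) →
                  mk⇔ (newPeaks-[1,m+1]-first⁻ m L′ pk spaced) (newPeaks-[1,m+1]-first⁺ m L′ 2≤m)
              ; (there (here refl)) → distinctₘ , λ pk (spaced , _) →
                  mk⇔ (newPeaks-[1,m+1]-at⁻ m L pk 2≤m m<L spaced) (newPeaks-[1,m+1]-at⁺ m L 2≤m m<L) }) ⟩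
    (cₘ + (c₁ₘ + 0) + ((c₁ + (c₁ₘ + (c₁ₘ₊₁ + 0))) + 0)) + (c₁ₘ₊₁ + 0)
      ≡⟨ solve 4 (λ a b c d → (a :+ (b :+ con 0) :+ ((c :+ (b :+ (d :+ con 0))) :+ con 0)) :+ (d :+ con 0)
                               := a :+ con 2 :* b :+ c :+ con 2 :* d) refl cₘ c₁ₘ c₁ c₁ₘ₊₁ ⟩
    cₘ + 2 * c₁ₘ + c₁ + 2 * c₁ₘ₊₁
      ∎
    where
      cₘ = count (m ∷ []) L
      c₁ₘ = count (1 ∷ m ∷ []) L
      c₁ = count (1 ∷ []) L
      c₁ₘ₊₁ = count (1 ∷ suc m ∷ []) L
      Ts : ℕ → List (List ℕ)
      Ts zero    = (m ∷ []) ∷ (1 ∷ m ∷ []) ∷ []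
      Ts (suc _) = (1 ∷ []) ∷ (1 ∷ m ∷ []) ∷ (1 ∷ suc m ∷ []) ∷ []
      distinctQ : Unique (0 ∷ m ∷ [])
      distinctQ = ((λ ()) ∷ []) ∷ [] ∷ []
      distinct₀ : Unique (Ts 0)
      distinct₀ = ((λ ()) ∷ []) ∷ [] ∷ []
      distinctₘ : Unique (Ts m)
      distinctₘ = ((λ ()) ∷ (λ ()) ∷ []) ∷ ((λ ()) ∷ []) ∷ [] ∷ []

  count-tooLarge : ∀ S L {z} → z ∈ S → L ≤ z → count S L ≡ 0
  count-tooLarge S L z∈ L≤z = count-impossible S L λ { pk (_ , pk<L) refl → <-irrefl refl (≤-trans (All.lookup pk<L z∈) L≤z) }

  count-[0] : ∀ L → count (0 ∷ []) L ≡ 0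
  count-[0] L = count-impossible _ L λ { pk ((() , _) , _) refl }

  count-[1,2] : ∀ L → count (1 ∷ 2 ∷ []) L ≡ 0
  count-[1,2] L = count-impossible _ L λ { pk ((_ , s≤s (s≤s ()) , _) , _) refl }

  -- Closed forms

  ∸-suc : ∀ {m n} → n < m → m ∸ n ≡ suc (m ∸ suc n)
  ∸-suc n<m = +-∸-assoc 1 n<m

  [1+n]C[n]≡1+n : ∀ n → suc n C n ≡ suc n
  [1+n]C[n]≡1+n n = trans (nCk≡nC[n∸k] (n≤1+n n)) (trans (cong (suc n C_) (m+n∸n≡m 1 n)) (nC1≡n (suc n)))

  count-[1]-suc : ∀ L → 0 < L → count (1 ∷ []) (suc L) ≡ 1 + 2 * count (1 ∷ []) L
  count-[1]-suc L 0<L =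
    trans (count-[k+1]-suc 0 L 0<L) (cong₂ (λ c₀ c₀′ → c₀ + c₀′ + 2 * count (1 ∷ []) L) (count-[] L) (count-[0] L))

  pairCount : ℕ → ℕ → ℕ
  pairCount k n = count (suc k ∷ []) n + count (k ∷ []) n + 1

  pairCount-first-suc : ∀ N → pairCount 0 (2 + N) ≡ 2 * pairCount 0 (1 + N)
  pairCount-first-suc N = begin
    a₁′ + count (0 ∷ []) (2 + N) + 1 ≡⟨ cong₂ (λ x y → x + y + 1) (count-[1]-suc (1 + N) (s≤s z≤n)) (count-[0] (2 + N)) ⟩
    1 + 2 * a₁ + 0 + 1              ≡⟨ solve 1 (λ a → con 1 :+ con 2 :* a :+ con 0 :+ con 1 := con 2 :* (a :+ con 0 :+ con 1)) refl a₁ ⟩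
    2 * (a₁ + 0 + 1)                ≡⟨ cong (λ z → 2 * (a₁ + z + 1)) (sym (count-[0] (1 + N))) ⟩
    2 * pairCount 0 (1 + N)         ∎
    where
      a₁ = count (1 ∷ []) (1 + N)
      a₁′ = count (1 ∷ []) (2 + N)

  pairCount-suc : ∀ k N → suc k < N → pairCount (suc k) (suc N) ≡ 2 * pairCount (suc k) N + pairCount k N
  pairCount-suc k N k+1<N = begin
    pairCount (suc k) (suc N)
      ≡⟨ cong₂ (λ x y → x + y + 1) (count-[k+1]-suc (suc k) N k+1<N) (count-[k+1]-suc k N (≤-trans (n≤1+n _) k+1<N)) ⟩
    (c₀ + aₖ₊₁ + 2 * aₖ₊₂) + (c₀ + aₖ + 2 * aₖ₊₁) + 1
      ≡⟨ cong (λ c → (c + aₖ₊₁ + 2 * aₖ₊₂) + (c + aₖ + 2 * aₖ₊₁) + 1) (count-[] N) ⟩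
    (1 + aₖ₊₁ + 2 * aₖ₊₂) + (1 + aₖ + 2 * aₖ₊₁) + 1
      ≡⟨ solve 3 (λ a b c → (con 1 :+ b :+ con 2 :* c) :+ (con 1 :+ a :+ con 2 :* b) :+ con 1
                            := con 2 :* (c :+ b :+ con 1) :+ (b :+ a :+ con 1)) refl aₖ aₖ₊₁ aₖ₊₂ ⟩
    2 * pairCount (suc k) N + pairCount k N
      ∎
    where
      c₀ = count [] N
      aₖ = count (k ∷ []) N
      aₖ₊₁ = count (suc k ∷ []) N
      aₖ₊₂ = count (suc (suc k) ∷ []) N

  pairCount-top : ∀ k → pairCount (suc k) (2 + k) ≡ 1 + pairCount k (1 + k)
  pairCount-top k = begin
    pairCount (suc k) (2 + k)
      ≡⟨ cong₂ (λ x y → x + y + 1) (count-tooLarge _ (2 + k) (here refl) ≤-refl) (count-[k+1]-suc k (1 + k) ≤-refl) ⟩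
    0 + (c₀ + aₖ + 2 * aₖ₊₁) + 1
      ≡⟨ cong₂ (λ c a → 0 + (c + aₖ + 2 * a) + 1) (count-[] (1 + k)) (count-tooLarge _ (1 + k) (here refl) ≤-refl) ⟩
    0 + (1 + aₖ + 2 * 0) + 1
      ≡⟨ solve 1 (λ a → con 0 :+ (con 1 :+ a :+ con 2 :* con 0) :+ con 1 := con 1 :+ (con 0 :+ a :+ con 1)) refl aₖ ⟩
    1 + (0 + aₖ + 1)
      ≡⟨ cong (λ a → 1 + (a + aₖ + 1)) (sym (count-tooLarge _ (1 + k) (here refl) ≤-refl)) ⟩
    1 + pairCount k (1 + k)
      ∎
    where
      c₀ = count [] (1 + k)
      aₖ = count (k ∷ []) (1 + k)
      aₖ₊₁ = count (suc k ∷ []) (1 + k)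

  pascal-pow : ∀ n k → k < n → 2 * ((suc n C suc k) * 2 ^ (n ∸ suc k)) + (suc n C k) * 2 ^ (n ∸ k)
                               ≡ (suc (suc n) C suc k) * 2 ^ (n ∸ k)
  pascal-pow n k k<n = begin
    2 * (x * p) + y * 2 ^ (n ∸ k)   ≡⟨ cong (λ e → 2 * (x * p) + y * 2 ^ e) (∸-suc k<n) ⟩
    2 * (x * p) + y * (2 * p)       ≡⟨ solve 3 (λ x y p → con 2 :* (x :* p) :+ y :* (con 2 :* p) := (y :+ x) :* (con 2 :* p)) refl x y p ⟩
    (y + x) * (2 * p)               ≡⟨ cong₂ _*_ (nCk+nC[k+1]≡[n+1]C[k+1] (suc n) k) (cong (2 ^_) (sym (∸-suc k<n))) ⟩
    (suc (suc n) C suc k) * 2 ^ (n ∸ k) ∎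
    where
      x = suc n C suc k
      y = suc n C k
      p = 2 ^ (n ∸ suc k)

  pairCount≡ : ∀ N k → k ≤ N → pairCount k (suc N) ≡ (suc N C k) * 2 ^ (N ∸ k)
  pairCount≡ zero    zero    _ = refl
  pairCount≡ (suc N) zero    _ = begin
    pairCount 0 (2 + N)      ≡⟨ pairCount-first-suc N ⟩
    2 * pairCount 0 (1 + N)  ≡⟨ cong (2 *_) (pairCount≡ N 0 z≤n) ⟩
    2 * (1 * 2 ^ N)          ≡⟨ solve 1 (λ p → con 2 :* (con 1 :* p) := con 1 :* (con 2 :* p)) refl (2 ^ N) ⟩
    1 * 2 ^ suc N            ∎
  pairCount≡ (suc N) (suc k) (s≤s k≤N) with m≤n⇒m<n∨m≡n k≤N
  ... | inj₁ k<N = begin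
    pairCount (suc k) (2 + N)
      ≡⟨ pairCount-suc k (suc N) (s≤s k<N) ⟩
    2 * pairCount (suc k) (1 + N) + pairCount k (1 + N)
      ≡⟨ cong₂ (λ x y → 2 * x + y) (pairCount≡ N (suc k) k<N) (pairCount≡ N k k≤N) ⟩
    2 * ((suc N C suc k) * 2 ^ (N ∸ suc k)) + (suc N C k) * 2 ^ (N ∸ k)
      ≡⟨ pascal-pow N k k<N ⟩
    (suc (suc N) C suc k) * 2 ^ (N ∸ k)
      ∎
  ... | inj₂ refl = begin
    pairCount (suc k) (2 + k)              ≡⟨ pairCount-top k ⟩
    1 + pairCount k (1 + k)                ≡⟨ cong (1 +_) (pairCount≡ k k ≤-refl) ⟩
    1 + (suc k C k) * 2 ^ (k ∸ k)          ≡⟨ cong₂ (λ c e → 1 + c * 2 ^ e) ([1+n]C[n]≡1+n k) (n∸n≡0 k) ⟩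
    1 + suc k * 1                          ≡⟨ cong₂ (λ c e → c * 2 ^ e) (sym ([1+n]C[n]≡1+n (suc k))) (sym (n∸n≡0 k)) ⟩
    (suc (suc k) C suc k) * 2 ^ (k ∸ k)    ∎

  count-[1] : ∀ N → count (1 ∷ []) (suc N) + 1 ≡ 2 ^ N
  count-[1] N = begin
    count (1 ∷ []) (suc N) + 1       ≡⟨ cong (λ a → a + 1) (sym (+-identityʳ _)) ⟩
    count (1 ∷ []) (suc N) + 0 + 1   ≡⟨ cong (λ a → count (1 ∷ []) (suc N) + a + 1) (sym (count-[0] (suc N))) ⟩
    pairCount 0 (suc N)              ≡⟨ pairCount≡ N 0 z≤n ⟩
    1 * 2 ^ N                        ≡⟨ *-identityˡ (2 ^ N) ⟩
    2 ^ N                            ∎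

  tripleCount : ℕ → ℕ → ℕ
  tripleCount m n = count (1 ∷ suc m ∷ []) n + count (1 ∷ m ∷ []) n + count (1 ∷ []) n

  tripleCount-2-suc : ∀ L → 2 < L → tripleCount 2 (suc L) ≡ pairCount 1 L + 2 * tripleCount 2 L
  tripleCount-2-suc L 2<L = begin
    tripleCount 2 (suc L)
      ≡⟨ cong₂ _+_ (cong₂ _+_ (count-[1,m+1]-suc 2 L ≤-refl 2<L) (count-[1,2] (suc L)))
                   (count-[1]-suc L (≤-trans (s≤s z≤n) 2<L)) ⟩
    (a₂ + 2 * f₂ + a₁ + 2 * f₃) + 0 + (1 + 2 * a₁)
      ≡⟨ cong (λ f → (a₂ + 2 * f + a₁ + 2 * f₃) + 0 + (1 + 2 * a₁)) (count-[1,2] L) ⟩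
    (a₂ + 2 * 0 + a₁ + 2 * f₃) + 0 + (1 + 2 * a₁)
      ≡⟨ solve 3 (λ a₁ a₂ f₃ → (a₂ :+ con 2 :* con 0 :+ a₁ :+ con 2 :* f₃) :+ con 0 :+ (con 1 :+ con 2 :* a₁)
                               := (a₂ :+ a₁ :+ con 1) :+ con 2 :* (f₃ :+ con 0 :+ a₁)) refl a₁ a₂ f₃ ⟩
    pairCount 1 L + 2 * (f₃ + 0 + a₁)
      ≡⟨ cong (λ f → pairCount 1 L + 2 * (f₃ + f + a₁)) (sym (count-[1,2] L)) ⟩
    pairCount 1 L + 2 * tripleCount 2 L
      ∎
    where
      a₁ = count (1 ∷ []) L
      a₂ = count (2 ∷ []) L
      f₂ = count (1 ∷ 2 ∷ []) L
      f₃ = count (1 ∷ 3 ∷ []) L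

  tripleCount-suc : ∀ m L → 2 ≤ m → suc m < L →
                    tripleCount (suc m) (suc L) ≡ pairCount m L + 2 * tripleCount (suc m) L + 2 * tripleCount m L
  tripleCount-suc m L 2≤m m+1<L = begin
    tripleCount (suc m) (suc L)
      ≡⟨ cong₂ _+_ (cong₂ _+_ (count-[1,m+1]-suc (suc m) L (≤-trans 2≤m (n≤1+n m)) m+1<L)
                              (count-[1,m+1]-suc m L 2≤m (≤-trans (n≤1+n _) m+1<L)))
                   (count-[1]-suc L (≤-trans (s≤s z≤n) m+1<L)) ⟩
    (aₘ₊₁ + 2 * fₘ₊₁ + a₁ + 2 * fₘ₊₂) + (aₘ + 2 * fₘ + a₁ + 2 * fₘ₊₁) + (1 + 2 * a₁)
      ≡⟨ solve 6 (λ a₁ aₘ aₘ₊₁ fₘ fₘ₊₁ fₘ₊₂ →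
                    (aₘ₊₁ :+ con 2 :* fₘ₊₁ :+ a₁ :+ con 2 :* fₘ₊₂) :+ (aₘ :+ con 2 :* fₘ :+ a₁ :+ con 2 :* fₘ₊₁)
                      :+ (con 1 :+ con 2 :* a₁)
                    := (aₘ₊₁ :+ aₘ :+ con 1) :+ con 2 :* (fₘ₊₂ :+ fₘ₊₁ :+ a₁) :+ con 2 :* (fₘ₊₁ :+ fₘ :+ a₁))
                 refl a₁ aₘ aₘ₊₁ fₘ fₘ₊₁ fₘ₊₂ ⟩
    pairCount m L + 2 * tripleCount (suc m) L + 2 * tripleCount m L
      ∎
    where
      a₁ = count (1 ∷ []) L
      aₘ = count (m ∷ []) L
      aₘ₊₁ = count (suc m ∷ []) L
      fₘ = count (1 ∷ m ∷ []) L
      fₘ₊₁ = count (1 ∷ suc m ∷ []) L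
      fₘ₊₂ = count (1 ∷ suc (suc m) ∷ []) L

  tripleCount-top : ∀ m → 2 ≤ m →
                    tripleCount (suc m) (2 + m) ≡ pairCount m (1 + m) + 2 * tripleCount m (1 + m) + count (1 ∷ []) (1 + m)
  tripleCount-top m 2≤m = begin
    tripleCount (suc m) (2 + m)
      ≡⟨ cong₂ _+_ (cong₂ _+_ (count-tooLarge _ (2 + m) (there (here refl)) ≤-refl)
                              (count-[1,m+1]-suc m (1 + m) 2≤m ≤-refl))
                   (count-[1]-suc (1 + m) (s≤s z≤n)) ⟩
    0 + (aₘ + 2 * fₘ + a₁ + 2 * fₘ₊₁) + (1 + 2 * a₁)
      ≡⟨ cong (λ f → 0 + (aₘ + 2 * fₘ + a₁ + 2 * f) + (1 + 2 * a₁)) vanishₘ₊₁ ⟩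
    0 + (aₘ + 2 * fₘ + a₁ + 2 * 0) + (1 + 2 * a₁)
      ≡⟨ solve 3 (λ a₁ aₘ fₘ → con 0 :+ (aₘ :+ con 2 :* fₘ :+ a₁ :+ con 2 :* con 0) :+ (con 1 :+ con 2 :* a₁)
                               := (con 0 :+ aₘ :+ con 1) :+ con 2 :* (con 0 :+ fₘ :+ a₁) :+ a₁) refl a₁ aₘ fₘ ⟩
    (0 + aₘ + 1) + 2 * (0 + fₘ + a₁) + a₁
      ≡⟨ cong₂ (λ a f → (a + aₘ + 1) + 2 * (f + fₘ + a₁) + a₁)
               (sym (count-tooLarge _ (1 + m) (here refl) ≤-refl)) (sym vanishₘ₊₁) ⟩
    pairCount m (1 + m) + 2 * tripleCount m (1 + m) + a₁
      ∎
    where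
      a₁ = count (1 ∷ []) (1 + m)
      aₘ = count (m ∷ []) (1 + m)
      fₘ = count (1 ∷ m ∷ []) (1 + m)
      fₘ₊₁ = count (1 ∷ suc m ∷ []) (1 + m)
      vanishₘ₊₁ : fₘ₊₁ ≡ 0
      vanishₘ₊₁ = count-tooLarge _ (1 + m) (there (here refl)) ≤-refl

  -- C(n,m) (2^(n-2) - 2^(n-1-m)) for n = N + 1, with the subtraction moved to the left
  TripleCountFormula : ℕ → ℕ → Set
  TripleCountFormula N m = tripleCount m (suc N) + (suc N C m) * 2 ^ (N ∸ m) ≡ (suc N C m) * 2 ^ (N ∸ 1)

  TripleCountFormula-2-suc : ∀ L → 2 ≤ L → TripleCountFormula L 2 → TripleCountFormula (suc L) 2
  TripleCountFormula-2-suc L 2≤L ih = begin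
    tripleCount 2 (2 + L) + (suc (suc L) C 2) * 2 ^ (L ∸ 1)
      ≡⟨ cong₂ _+_ (tripleCount-2-suc (suc L) (s≤s 2≤L)) (cong₂ _*_ (sym (nCk+nC[k+1]≡[n+1]C[k+1] (suc L) 1)) t≡2p) ⟩
    pairCount 1 (suc L) + 2 * τ + (c₁ + c₂) * (2 * p)
      ≡⟨ cong (λ x → x + 2 * τ + (c₁ + c₂) * (2 * p)) (trans (pairCount≡ L 1 1≤L) (cong (c₁ *_) t≡2p)) ⟩
    c₁ * (2 * p) + 2 * τ + (c₁ + c₂) * (2 * p)
      ≡⟨ solve 4 (λ τ c₁ c₂ p → c₁ :* (con 2 :* p) :+ con 2 :* τ :+ (c₁ :+ c₂) :* (con 2 :* p)
                               := con 2 :* (τ :+ c₂ :* p) :+ con 2 :* (c₁ :* (con 2 :* p))) refl τ c₁ c₂ p ⟩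
    2 * (τ + c₂ * p) + 2 * (c₁ * (2 * p))
      ≡⟨ cong₂ (λ x y → 2 * x + 2 * (c₁ * y)) ih (sym t≡2p) ⟩
    2 * (c₂ * t) + 2 * (c₁ * t)
      ≡⟨ solve 3 (λ c₁ c₂ t → con 2 :* (c₂ :* t) :+ con 2 :* (c₁ :* t) := (c₁ :+ c₂) :* (con 2 :* t)) refl c₁ c₂ t ⟩
    (c₁ + c₂) * (2 * t)
      ≡⟨ cong₂ _*_ (nCk+nC[k+1]≡[n+1]C[k+1] (suc L) 1) (cong (2 ^_) (sym (∸-suc 1≤L))) ⟩
    (suc (suc L) C 2) * 2 ^ L
      ∎
    where
      1≤L = ≤-trans (s≤s z≤n) 2≤L
      τ = tripleCount 2 (suc L)
      c₁ = suc L C 1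
      c₂ = suc L C 2
      p = 2 ^ (L ∸ 2)
      t = 2 ^ (L ∸ 1)
      t≡2p : t ≡ 2 * p
      t≡2p = cong (2 ^_) (∸-suc 2≤L)

  TripleCountFormula-suc : ∀ L k → 2 ≤ k → k < L →
    TripleCountFormula L (suc k) → TripleCountFormula L k → TripleCountFormula (suc L) (suc k)
  TripleCountFormula-suc L k 2≤k k<L ih₁ ih₀ = begin
    tripleCount (suc k) (2 + L) + (suc (suc L) C suc k) * 2 ^ (L ∸ k)
      ≡⟨ cong₂ _+_ (tripleCount-suc k (suc L) 2≤k (s≤s k<L)) (cong₂ _*_ (sym (nCk+nC[k+1]≡[n+1]C[k+1] (suc L) k)) 2^[L∸k]) ⟩
    pairCount k (suc L) + 2 * τ₁ + 2 * τ₀ + (cₖ + cₖ₊₁) * (2 * p)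
      ≡⟨ cong (λ x → x + 2 * τ₁ + 2 * τ₀ + (cₖ + cₖ₊₁) * (2 * p))
              (trans (pairCount≡ L k (≤-trans (n≤1+n k) k<L)) (cong (cₖ *_) 2^[L∸k])) ⟩
    cₖ * (2 * p) + 2 * τ₁ + 2 * τ₀ + (cₖ + cₖ₊₁) * (2 * p)
      ≡⟨ solve 5 (λ τ₀ τ₁ cₖ cₖ₊₁ p → cₖ :* (con 2 :* p) :+ con 2 :* τ₁ :+ con 2 :* τ₀ :+ (cₖ :+ cₖ₊₁) :* (con 2 :* p)
                                     := con 2 :* (τ₁ :+ cₖ₊₁ :* p) :+ con 2 :* (τ₀ :+ cₖ :* (con 2 :* p)))
                 refl τ₀ τ₁ cₖ cₖ₊₁ p ⟩
    2 * (τ₁ + cₖ₊₁ * p) + 2 * (τ₀ + cₖ * (2 * p))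
      ≡⟨ cong₂ (λ x y → 2 * x + 2 * y) ih₁ (trans (cong (λ z → τ₀ + cₖ * z) (sym 2^[L∸k])) ih₀) ⟩
    2 * (cₖ₊₁ * t) + 2 * (cₖ * t)
      ≡⟨ solve 3 (λ cₖ cₖ₊₁ t → con 2 :* (cₖ₊₁ :* t) :+ con 2 :* (cₖ :* t) := (cₖ :+ cₖ₊₁) :* (con 2 :* t))
                 refl cₖ cₖ₊₁ t ⟩
    (cₖ + cₖ₊₁) * (2 * t)
      ≡⟨ cong₂ _*_ (nCk+nC[k+1]≡[n+1]C[k+1] (suc L) k) (cong (2 ^_) (sym (∸-suc (≤-trans (s≤s z≤n) k<L)))) ⟩
    (suc (suc L) C suc k) * 2 ^ L
      ∎
    where
      τ₀ = tripleCount k (suc L)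
      τ₁ = tripleCount (suc k) (suc L)
      cₖ = suc L C k
      cₖ₊₁ = suc L C suc k
      p = 2 ^ (L ∸ suc k)
      t = 2 ^ (L ∸ 1)
      2^[L∸k] : 2 ^ (L ∸ k) ≡ 2 * p
      2^[L∸k] = cong (2 ^_) (∸-suc k<L)

  TripleCountFormula-top : ∀ k → 2 ≤ k → TripleCountFormula k k → TripleCountFormula (suc k) (suc k)
  TripleCountFormula-top k 2≤k ih = begin
    tripleCount (suc k) (2 + k) + (suc (suc k) C suc k) * 2 ^ (k ∸ k)
      ≡⟨ cong₂ _+_ (tripleCount-top k 2≤k) (cong₂ (λ c e → c * 2 ^ e) ([1+n]C[n]≡1+n (suc k)) (n∸n≡0 k)) ⟩
    pairCount k (1 + k) + 2 * τ + a₁ + (2 + k) * 1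
      ≡⟨ cong (λ x → x + 2 * τ + a₁ + (2 + k) * 1) (trans (pairCount≡ k k ≤-refl) top-binomial) ⟩
    (1 + k) * 1 + 2 * τ + a₁ + (2 + k) * 1
      ≡⟨ solve 3 (λ τ a₁ k → (con 1 :+ k) :* con 1 :+ con 2 :* τ :+ a₁ :+ (con 2 :+ k) :* con 1
                             := con 2 :* (τ :+ (con 1 :+ k) :* con 1) :+ (a₁ :+ con 1)) refl τ a₁ k ⟩
    2 * (τ + (1 + k) * 1) + (a₁ + 1)
      ≡⟨ cong₂ (λ x y → 2 * x + y) ih′ (trans (count-[1] k) (cong (2 ^_) (∸-suc (≤-trans (s≤s z≤n) 2≤k)))) ⟩
    2 * ((1 + k) * t) + 2 * t
      ≡⟨ solve 2 (λ k t → con 2 :* ((con 1 :+ k) :* t) :+ con 2 :* t := (con 2 :+ k) :* (con 2 :* t)) refl k t ⟩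
    (2 + k) * (2 * t)
      ≡⟨ cong₂ _*_ (sym ([1+n]C[n]≡1+n (suc k))) (cong (2 ^_) (sym (∸-suc (≤-trans (s≤s z≤n) 2≤k)))) ⟩
    (suc (suc k) C suc k) * 2 ^ k
      ∎
    where
      τ = tripleCount k (1 + k)
      a₁ = count (1 ∷ []) (1 + k)
      t = 2 ^ (k ∸ 1)
      top-binomial : (suc k C k) * 2 ^ (k ∸ k) ≡ (1 + k) * 1
      top-binomial = cong₂ (λ c e → c * 2 ^ e) ([1+n]C[n]≡1+n k) (n∸n≡0 k)
      ih′ : τ + (1 + k) * 1 ≡ (1 + k) * t
      ih′ = trans (cong (τ +_) (sym top-binomial)) (trans ih (cong (_* t) ([1+n]C[n]≡1+n k)))

  tripleCountFormula : ∀ N m → 2 ≤ m → m ≤ N → TripleCountFormula N m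
  tripleCountFormula N 0 () _
  tripleCountFormula N 1 (s≤s ()) _
  tripleCountFormula 2 2 _ _ = refl
  tripleCountFormula (suc L@(suc (suc _))) 2 _ _ =
    TripleCountFormula-2-suc L (s≤s (s≤s z≤n)) (tripleCountFormula L 2 ≤-refl (s≤s (s≤s z≤n)))
  tripleCountFormula (suc L) (suc k@(suc (suc _))) _ (s≤s k≤L) with m≤n⇒m<n∨m≡n k≤L
  ... | inj₁ k<L = TripleCountFormula-suc L k (s≤s (s≤s z≤n)) k<L
                     (tripleCountFormula L (suc k) (s≤s (s≤s z≤n)) k<L) (tripleCountFormula L k (s≤s (s≤s z≤n)) k≤L)
  ... | inj₂ refl = TripleCountFormula-top k (s≤s (s≤s z≤n)) (tripleCountFormula k k (s≤s (s≤s z≤n)) ≤-refl)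

open PeakSetCounts using (count; countPeakSet≡count; count-[1,2]; count-[1]; tripleCountFormula)
open import Data.Nat as ℕ using (ℕ; zero; suc; _≤_; _∸_; _%_; z≤n; s≤s)
import Data.Nat.Properties as ℕ
open import Data.Nat.Combinatorics using (_C_)
open import Data.Integer using (ℤ; +_; _+_; _-_; _*_; -_; -1ℤ; _^_)
import Data.Integer.Properties as ℤ
open import Data.Integer.Solver using (module +-*-Solver)
open +-*-Solver using (solve; _:+_; _:*_; _:-_; :-_; _:=_; con)
open import Data.List using (List; []; _∷_; foldr; applyUpTo)
open import Data.List.Properties using (map-applyUpTo)
open import Relation.Binary.PropositionalEquality using (_≡_; refl; sym; trans; cong; cong₂)
open Relation.Binary.PropositionalEquality.≡-Reasoning

-- The alternating sum

term : ℕ → ℕ → ℕ → ℤ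
term n m i = + (n C (m ∸ i)) * (+ (2 ℕ.^ (m ∸ i ∸ 1)) - + 1) * + (2 ℕ.^ (n ∸ (m ∸ i ℕ.+ 1))) * (-1ℤ ^ (i ℕ.+ 1))

formula : ℕ → ℕ → ℤ
formula n m = sumℤ 1 (m ∸ 2) (term n m) - + (m % 2) * (+ (2 ℕ.^ (n ∸ 1)) - + 1)

∑ℤ : List ℤ → ℤ
∑ℤ = foldr _+_ (+ 0)

sumℤ-from-1 : ∀ b (f : ℕ → ℤ) → sumℤ 1 b f ≡ ∑ℤ (applyUpTo (λ j → f (suc j)) b)
sumℤ-from-1 b f = cong ∑ℤ (map-applyUpTo (λ j → j) (λ j → f (suc j)) b)

∑ℤ-applyUpTo-neg : ∀ k (F G : ℕ → ℤ) → (∀ j → F j ≡ - G j) → ∑ℤ (applyUpTo F k) ≡ - ∑ℤ (applyUpTo G k)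
∑ℤ-applyUpTo-neg zero    F G F≗-G = refl
∑ℤ-applyUpTo-neg (suc k) F G F≗-G =
  trans (cong₂ _+_ (F≗-G 0) (∑ℤ-applyUpTo-neg k (λ j → F (suc j)) (λ j → G (suc j)) (λ j → F≗-G (suc j))))
        (sym (ℤ.neg-distrib-+ (G 0) (∑ℤ (applyUpTo (λ j → G (suc j)) k))))

sumℤ-alternate : ∀ k (f g : ℕ → ℤ) → (∀ i → f (2 ℕ.+ i) ≡ - g (1 ℕ.+ i)) → sumℤ 1 (suc k) f ≡ f 1 - sumℤ 1 k g
sumℤ-alternate k f g f≗-g = begin
  sumℤ 1 (suc k) f                                   ≡⟨ sumℤ-from-1 (suc k) f ⟩
  f 1 + ∑ℤ (applyUpTo (λ j → f (2 ℕ.+ j)) k)         ≡⟨ cong (λ s → f 1 + s) (∑ℤ-applyUpTo-neg k _ _ f≗-g) ⟩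
  f 1 - ∑ℤ (applyUpTo (λ j → g (1 ℕ.+ j)) k)         ≡⟨ cong (λ s → f 1 - s) (sym (sumℤ-from-1 k g)) ⟩
  f 1 - sumℤ 1 k g                                   ∎

term-shift : ∀ n m i → term n (suc m) (2 ℕ.+ i) ≡ - term n m (1 ℕ.+ i)
term-shift n m i = solve 4 (λ a b c s → a :* b :* c :* (con -1ℤ :* s) := :- (a :* b :* c :* s)) refl
  (+ (n C (m ∸ suc i))) (+ (2 ℕ.^ (m ∸ suc i ∸ 1)) - + 1) (+ (2 ℕ.^ (n ∸ (m ∸ suc i ℕ.+ 1)))) (-1ℤ ^ (suc i ℕ.+ 1))

%2-suc : ∀ m → suc m % 2 ℕ.+ m % 2 ≡ 1
%2-suc zero          = refl
%2-suc (suc zero)    = refl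
%2-suc (suc (suc m)) = %2-suc m

formula-step : ∀ n k → formula n (3 ℕ.+ k) + formula n (2 ℕ.+ k) ≡ term n (3 ℕ.+ k) 1 - (+ (2 ℕ.^ (n ∸ 1)) - + 1)
formula-step n k = begin
  (Σ₃ - c₃ * P) + (Σ₂ - c₂ * P)
    ≡⟨ cong (λ s → (s - c₃ * P) + (Σ₂ - c₂ * P))
            (sumℤ-alternate k (term n (3 ℕ.+ k)) (term n (2 ℕ.+ k)) (term-shift n (2 ℕ.+ k))) ⟩
  (g - Σ₂ - c₃ * P) + (Σ₂ - c₂ * P)
    ≡⟨ solve 5 (λ g s c₃ c₂ p → (g :- s :- c₃ :* p) :+ (s :- c₂ :* p) := g :- (c₃ :+ c₂) :* p) refl g Σ₂ c₃ c₂ P ⟩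
  g - (c₃ + c₂) * P
    ≡⟨ cong (λ c → g - c * P) (trans (sym (ℤ.pos-+ ((3 ℕ.+ k) % 2) ((2 ℕ.+ k) % 2))) (cong +_ (%2-suc (2 ℕ.+ k)))) ⟩
  g - + 1 * P
    ≡⟨ cong (λ x → g - x) (ℤ.*-identityˡ P) ⟩
  g - P
    ∎
  where
    g = term n (3 ℕ.+ k) 1
    Σ₃ = sumℤ 1 (1 ℕ.+ k) (term n (3 ℕ.+ k))
    Σ₂ = sumℤ 1 k (term n (2 ℕ.+ k))
    c₃ = + ((3 ℕ.+ k) % 2)
    c₂ = + ((2 ℕ.+ k) % 2)
    P = + (2 ℕ.^ (n ∸ 1)) - + 1

∸1+∸ : ∀ {m N} → 1 ≤ m → m ≤ N → m ∸ 1 ℕ.+ (N ∸ m) ≡ N ∸ 1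
∸1+∸ {suc m} {suc N} _ (s≤s m≤N) = ℕ.m+[n∸m]≡n m≤N

count-[1,m+1]≡ : ∀ N m → 2 ≤ m → m ≤ N →
  + count (1 ∷ suc m ∷ []) (suc N) ≡ term (suc N) (suc m) 1 - (+ (2 ℕ.^ N) - + 1) - + count (1 ∷ m ∷ []) (suc N)
count-[1,m+1]≡ N m 2≤m m≤N = begin
  + x
    ≡⟨ solve 5 (λ x y a c q → x := (x :+ y :+ a :+ c :* q) :- y :- a :- c :* q) refl (+ x) (+ y) (+ a) (+ c) (+ q) ⟩
  (+ x + + y + + a + + c * + q) - + y - + a - + c * + q
    ≡⟨ cong (λ s → s - + y - + a - + c * + q) formulaℤ ⟩
  + c * (+ r * + q) - + y - + a - + c * + q
    ≡⟨ solve 5 (λ y a c r q → c :* (r :* q) :- y :- a :- c :* q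
                              := c :* (r :- con (+ 1)) :* q :* (con -1ℤ :* (con -1ℤ :* con (+ 1))) :- ((a :+ con (+ 1)) :- con (+ 1)) :- y)
               refl (+ y) (+ a) (+ c) (+ r) (+ q) ⟩
  + c * (+ r - + 1) * + q * (-1ℤ ^ 2) - ((+ a + + 1) - + 1) - + y
    ≡⟨ cong₂ (λ e s → + c * (+ r - + 1) * + (2 ℕ.^ (suc N ∸ e)) * (-1ℤ ^ 2) - (s - + 1) - + y)
             (ℕ.+-comm 1 m) (trans (sym (ℤ.pos-+ a 1)) (cong +_ (count-[1] N))) ⟩
  term (suc N) (suc m) 1 - (+ (2 ℕ.^ N) - + 1) - + y
    ∎
  where
    x = count (1 ∷ suc m ∷ []) (suc N)
    y = count (1 ∷ m ∷ []) (suc N)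
    a = count (1 ∷ []) (suc N)
    c = suc N C m
    q = 2 ℕ.^ (N ∸ m)
    r = 2 ℕ.^ (m ∸ 1)
    2^[N∸1] : 2 ℕ.^ (N ∸ 1) ≡ r ℕ.* q
    2^[N∸1] = trans (cong (2 ℕ.^_) (sym (∸1+∸ (ℕ.≤-trans (s≤s z≤n) 2≤m) m≤N))) (ℕ.^-distribˡ-+-* 2 (m ∸ 1) (N ∸ m))
    formulaℤ : + x + + y + + a + + c * + q ≡ + c * (+ r * + q)
    formulaℤ = begin
      + x + + y + + a + + c * + q   ≡⟨ cong₂ _+_ (cong (_+ + a) (sym (ℤ.pos-+ x y))) (sym (ℤ.pos-* c q)) ⟩
      + (x ℕ.+ y) + + a + + (c ℕ.* q) ≡⟨ cong (_+ + (c ℕ.* q)) (sym (ℤ.pos-+ (x ℕ.+ y) a)) ⟩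
      + (x ℕ.+ y ℕ.+ a) + + (c ℕ.* q) ≡⟨ sym (ℤ.pos-+ (x ℕ.+ y ℕ.+ a) (c ℕ.* q)) ⟩
      + (x ℕ.+ y ℕ.+ a ℕ.+ c ℕ.* q)  ≡⟨ cong +_ (trans (tripleCountFormula N m 2≤m m≤N) (cong (c ℕ.*_) 2^[N∸1])) ⟩
      + (c ℕ.* (r ℕ.* q))            ≡⟨ trans (ℤ.pos-* c (r ℕ.* q)) (cong (+ c *_) (ℤ.pos-* r q)) ⟩
      + c * (+ r * + q)             ∎

count-[1,m]≡formula : ∀ N m → 2 ≤ m → m ≤ N → + count (1 ∷ m ∷ []) (suc N) ≡ formula (suc N) m
count-[1,m]≡formula N 1 (s≤s ()) _
count-[1,m]≡formula N 2 _        _ = cong +_ (count-[1,2] (suc N))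
count-[1,m]≡formula N (suc m@(suc (suc k))) _ m+1≤N = begin
  + count (1 ∷ suc m ∷ []) (suc N)
    ≡⟨ count-[1,m+1]≡ N m 2≤m m≤N ⟩
  g - P - + count (1 ∷ m ∷ []) (suc N)
    ≡⟨ cong (λ y → g - P - y) (count-[1,m]≡formula N m 2≤m m≤N) ⟩
  g - P - formula (suc N) m
    ≡⟨ cong (λ s → s - formula (suc N) m) (sym (formula-step (suc N) k)) ⟩
  formula (suc N) (suc m) + formula (suc N) m - formula (suc N) m
    ≡⟨ solve 2 (λ a b → a :+ b :- b := a) refl (formula (suc N) (suc m)) (formula (suc N) m) ⟩
  formula (suc N) (suc m)
    ∎
  where
    2≤m = s≤s (s≤s z≤n)
    m≤N = ℕ.≤-trans (ℕ.n≤1+n m) m+1≤N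
    g = term (suc N) (suc m) 1
    P = + (2 ℕ.^ N) - + 1

proposition4p10 : (n m : ℕ) → 3 ≤ m → m ≤ n ∸ 1 →
  + countPeakSet (1 ∷ m ∷ []) n ≡
    sumℤ 1 (m ∸ 2) (λ i →
        + (n C (m ∸ i)) * (+ (2 ℕ.^ (m ∸ i ∸ 1)) - + 1)
          * + (2 ℕ.^ (n ∸ (m ∸ i ℕ.+ 1))) * (-1ℤ ^ (i ℕ.+ 1)))
    - + (m % 2) * (+ (2 ℕ.^ (n ∸ 1)) - + 1)
proposition4p10 zero    (suc _) _   ()
proposition4p10 (suc N) m 3≤m m≤N = begin
  + countPeakSet (1 ∷ m ∷ []) (suc N) ≡⟨ cong +_ (countPeakSet≡count (1 ∷ m ∷ []) (suc N)) ⟩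
  + count (1 ∷ m ∷ []) (suc N)        ≡⟨ count-[1,m]≡formula N m (ℕ.≤-trans (ℕ.n≤1+n 2) 3≤m) m≤N ⟩
  formula (suc N) m                   ∎
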